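{- Let $n\in\mathbb{N}$ and $u,v\in\mathcal{A}_n^*$. Then $u\equiv_{\mathrm{hypo}} v$ if and only if $u\sim v$, i.e. if and only if there is a quasi-crystal isomorphism $\theta:\Gamma_n(u)\to\Gamma_n(v)$ with $\theta(u)=v$.
   Context: Let $\mathcal{A}_n=\{1<2<\dots<n\}$ and $\mathcal{A}_n^*$ the free monoid of words over it. The weight of a word $u$ is $\mathrm{wt}(u)=(|u|_1,\dots,|u|_n)$, where $|u|_a$ is the number of occurrences of $a$ in $u$. Quasi-Kashiwara operators: for $i\in\{1,\dots,n-1\}$, a word $u$ has an $i$-inversion if it contains a letter $i+1$ somewhere to the left of a letter $i$. If $u$ has an $i$-inversion, $e_i(u)$ and $f_i(u)$ are undefined. Otherwise, $e_i(u)$ is obtained by replacing the leftmost letter $i+1$ of $u$ by $i$ (undefined if $u$ has no letter $i+1$), and $f_i(u)$ is obtained by replacing the rightmost letter $i$ of $u$ by $i+1$ (undefined if $u$ has no letter $i$). The quasi-crystal graph $\Gamma_n$ is the directed graph with vertex set $\mathcal{A}_n^*$ and an edge $u\to f_i(u)$ labelled $i$ whenever $f_i(u)$ is defined. $\Gamma_n(u)$ denotes the connected component containing $u$. A quasi-crystal isomorphism between two components is a bijection preserving weight and such that there is an edge $x\to y$ labelled $i$ iff there is an edge between the images labelled $i$. Write $u\sim v$ if there is a quasi-crystal isomorphism $\theta:\Gamma_n(u)\to\Gamma_n(v)$ with $\theta(u)=v$. Quasi-ribbon tableaux: a composition $\alpha=(\alpha_1,\dots,\alpha_k)$ (positive parts)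 determines a ribbon diagram with $\alpha_h$ boxes in row $h$ (rows top to bottom), where the leftmost box of each row is directly below the rightmost box of the previous row. A quasi-ribbon tableau is such a diagram filled with positive integers so that rows weakly increase left to right and columns strictly increase top to bottom; its cells, listed along the ribbon from top-left to bottom-right, carry weakly increasing entries. Insertion of a letter $a$ into a quasi-ribbon tableau $T$ (Krob–Thibon): if no entry of $T$ is $\le a$ (including $T$ empty), create a cell $a$ and attach $T$ so that its first cell is directly below $a$; if no entry of $T$ is $>a$, attach a new cell $a$ directly to the right of the last cell of $T$; otherwise let $x$ be the last cell (along the ribbon) with entry $\le a$ and $z$ the next cell, and form the tableau consisting of the part of $T$ up to $x$, a new cell $a$ directly to the right of $x$, and the remainder of $T$ from $z$ onwards attached so that $z$ is directly below the new cell $a$. For a word $w=a_1\cdots a_k$, $\mathrm{QR}(w)$ is obtained by inserting $a_1,\dots,a_k$ successively starting from the empty tableau. The hypoplactic congruence is $u\equiv_{\mathrm{hypo}} v$ iff $\mathrm{QR}(u)=\mathrm{QR}(v)$. -}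

module Defs where

open import Data.Nat using (ℕ; zero; suc; _<_; _≡ᵇ_)
open import Data.Nat.Properties using (<-trans; n<1+n)
open import Data.Fin using (Fin; toℕ; fromℕ<; _≤?_)
open import Data.Bool using (Bool; true; false; if_then_else_; _∧_; _∨_)
open import Data.List using (List; []; _∷_; reverse; _++_)
open import Data.Bool.ListAction using (any)
open import Data.Maybe using (Maybe; just; nothing)
open import Data.Product using (Σ; ∃; ∃-syntax; _×_; _,_)
open import Data.Vec using (Vec; tabulate)
open import Relation.Nullary.Decidable using (does)
open import Relation.Binary.PropositionalEquality using (_≡_)
open import Relation.Binary.Construct.Closure.ReflexiveTransitive using (Star)
open import Relation.Binary.Construct.Closure.Symmetric using (SymClosure)
open import Function.Bundles using (_⇔_)

-- Alphabet and words.
-- The letter a ∈ {1,…,n} of the paper is represented by (a-1) : Fin n.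

Word : ℕ → Set
Word n = List (Fin n)

count : ∀ {n} → Fin n → Word n → ℕ
count a [] = 0
count a (c ∷ u) = if toℕ c ≡ᵇ toℕ a then suc (count a u) else count a u

wt : ∀ {n} → Word n → Vec ℕ n
wt u = tabulate (λ a → count a u)

-- The paper's index i ∈ {1,…,n-1} is represented by i-1 = k : ℕ with
-- suc k < n; then the paper's letters i and i+1 are (with 0-based
-- encoding) the Fin n elements of value k and suc k.

isVal : ∀ {n} → ℕ → Fin n → Bool
isVal k c = toℕ c ≡ᵇ k

hasInv : ∀ {n} → ℕ → Word n → Bool
hasInv k [] = false
hasInv k (c ∷ u) = (isVal (suc k) c ∧ any (isVal k) u) ∨ hasInv k u

replaceFirst : ∀ {n} → (Fin n → Bool) → Fin n → Word n → Maybe (Word n)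
replaceFirst p b [] = nothing
replaceFirst p b (c ∷ u) with p c
... | true = just (b ∷ u)
... | false with replaceFirst p b u
...   | just u' = just (c ∷ u')
...   | nothing = nothing

replaceLast : ∀ {n} → (Fin n → Bool) → Fin n → Word n → Maybe (Word n)
replaceLast p b [] = nothing
replaceLast p b (c ∷ u) with replaceLast p b u
... | just u' = just (c ∷ u')
... | nothing = if p c then just (b ∷ u) else nothing

eOp : ∀ {n} (k : ℕ) → suc k < n → Word n → Maybe (Word n)
eOp {n} k h u =
  if hasInv k u then nothing
  else replaceFirst (isVal (suc k)) (fromℕ< (<-trans (n<1+n k) h)) u

fOp : ∀ {n} (k : ℕ) → suc k < n → Word n → Maybe (Word n)
fOp {n} k h u =
  if hasInv k u then nothing
  else replaceLast (isVal k) (fromℕ< h) u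

Edge : ∀ {n} → ℕ → Word n → Word n → Set
Edge {n} k u w = Σ (suc k < n) (λ h → fOp k h u ≡ just w)

Adj : ∀ {n} → Word n → Word n → Set
Adj u w = ∃[ k ] Edge k u w

Conn : ∀ {n} → Word n → Word n → Set
Conn {n} = Star (SymClosure (Adj {n}))

IsQCIso : ∀ {n} → Word n → Word n → (Word n → Word n) → Set
IsQCIso {n} u v θ =
    (∀ x → Conn u x → Conn v (θ x))
  × (∀ x y → Conn u x → Conn u y → θ x ≡ θ y → x ≡ y)
  × (∀ y → Conn v y → ∃[ x ] (Conn u x × θ x ≡ y))
  × (∀ x → Conn u x → wt (θ x) ≡ wt x)
  × (∀ (k : ℕ) x y → Conn u x → Conn u y →
       Edge k x y ⇔ Edge k (θ x) (θ y))

_∼_ : ∀ {n} → Word n → Word n → Set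
_∼_ {n} u v = ∃[ θ ] (IsQCIso u v θ × θ u ≡ v)

-- A quasi-ribbon tableau is represented by the list of its cells along
-- the ribbon (top-left to bottom-right); each cell carries its entry and a
-- Bool which is true iff the cell is directly BELOW the previous cell
-- (i.e. starts a new row), false iff it is directly to the right of the
-- previous cell (the flag of the first cell is always false).  This list
-- determines the ribbon shape (composition) and filling exactly.

QRTab : ℕ → Set
QRTab n = List (Fin n × Bool)

attachBelow : ∀ {n} → QRTab n → QRTab n
attachBelow [] = []
attachBelow ((x , _) ∷ t) = (x , true) ∷ t

-- split T = P ++ S where S is the longest suffix all of whose entries are > a,
-- so that P ends with the last cell x with entry ≤ a (if any) and S starts
-- with the next cell z (if any).
splitAux : ∀ {n} → Fin n → List (Fin n × Bool) → QRTab n → QRTab n × QRTab n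
-- arguments: a, reversed remaining cells, suffix built so far
splitAux a [] s = [] , s
splitAux a ((x , b) ∷ r) s with does (x ≤? a)
... | true = reverse ((x , b) ∷ r) , s
... | false = splitAux a r ((x , b) ∷ s)

splitAt≤ : ∀ {n} → Fin n → QRTab n → QRTab n × QRTab n
splitAt≤ a t = splitAux a (reverse t) []

-- Krob–Thibon insertion of a into T.
--  * no entry ≤ a (P empty): new cell a, with T attached below it;
--  * no entry > a (S empty): a attached right of the last cell;
--  * otherwise: P, then a right of x, then S attached with z below a.
-- All three cases are the formula below.
insertQR : ∀ {n} → Fin n → QRTab n → QRTab n
insertQR a t with splitAt≤ a t
... | p , s = p ++ ((a , false) ∷ attachBelow s)

QRaux : ∀ {n} → QRTab n → Word n → QRTab n
QRaux t [] = t
QRaux t (a ∷ w) = QRaux (insertQR a t) w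

QR : ∀ {n} → Word n → QRTab n
QR w = QRaux [] w

_≡hypo_ : ∀ {n} → Word n → Word n → Set
u ≡hypo v = QR u ≡ QR v

-- The quasi-Kashiwara operators are intertwined by QR with operators fᵀ, eᵀ acting directly on
-- quasi-ribbon tableaux, and whether a word has an i-inversion can be read off its tableau. Every
-- quasi-Kashiwara operator preserves the standardization of a word, and a word is determined by its
-- standardization and its weight, so QR is injective on each component.
-- (⇒) If QR u = QR v, sending x to the word of Γ(v) with tableau QR x is a quasi-crystal
-- isomorphism Γ(u) → Γ(v), because QR commutes with the operators.
-- (⇐) A quasi-crystal isomorphism θ makes QR x and QR (θ x) bisimilar for the tableau operators,
-- and two tableaux with the same content that are bisimilar in this sense coincide.
module Submission where

open import Algebra.Bundles using (CommutativeMonoid)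
import Algebra.Properties.CommutativeSemigroup as CommutativeSemigroupProperties
open import Data.Bool using (Bool; true; false; T; if_then_else_; _∧_; _∨_)
import Data.Bool.Properties as Bool
open import Data.Bool.Properties
  using (T-≡; ¬-not; ∨-conicalˡ; ∨-conicalʳ; ∨-identityʳ; ∨-zeroʳ; ∨-assoc; ∧-identityʳ; ∧-zeroʳ; ∨-commutativeMonoid)
open import Data.Bool.ListAction using (any)
open import Data.Empty using (⊥; ⊥-elim)
open import Data.Fin using (Fin; toℕ; fromℕ<; _≤?_)
import Data.Fin.Properties as Fin
open import Data.Fin.Properties using (toℕ-fromℕ<; toℕ-injective; toℕ<n)
open import Data.List using (List; []; _∷_; _++_; _∷ʳ_; reverse; map; length)
import Data.List.Properties as List
open import Data.List.Properties
  using (++-assoc; ++-cancelˡ; ∷-injective; ++-identityʳ; map-++; reverse-++; unfold-reverse; reverse-involutive)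
open import Data.List.Relation.Unary.All using (All; []; _∷_)
import Data.List.Relation.Unary.All as All
open import Data.List.Relation.Unary.All.Properties using (∷ʳ⁻; ++⁻ˡ; ++⁻ʳ) renaming (++⁺ to All-++⁺)
open import Data.List.Relation.Unary.AllPairs using (AllPairs; []; _∷_)
open import Data.List.Reverse using (Reverse; []; _∶_∶ʳ_; reverseView)
open import Data.Maybe using (Maybe; just; nothing)
import Data.Maybe as Maybe
open import Data.Maybe.Properties using (just-injective)
open import Data.Nat using (ℕ; zero; suc; _+_; _≤_; _<_; _≡ᵇ_; _<ᵇ_; z≤n; s≤s; s≤s⁻¹; _<?_)
open import Data.Nat.Properties
  using (≡ᵇ⇒≡; ≡⇒≡ᵇ; <ᵇ⇒<; <⇒<ᵇ; _≟_; <-cmp; ≤-reflexive; ≤-trans; <-trans; <-irrefl; <-asym; <-≤-trans; ≤-<-trans;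
         <⇒≤; <⇒≱; ≰⇒>; ≮⇒≥; ≤∧≢⇒<; 1+n≢n; 0≢1+n; suc-injective; n<1+n; n≤1+n; m≤n⇒m≤1+n; m≤m+n;
         m≤n⇒∃[o]m+o≡n; +-suc; +-comm; +-identityʳ; +-monoʳ-≤; +-commutativeSemigroup; module ≤-Reasoning)
open import Data.Product using (∃-syntax; _×_; _,_; proj₁; proj₂)
import Data.Product.Properties as Product
open import Data.Unit using (⊤; tt)
open import Data.Vec using (lookup)
open import Data.Vec.Properties using (lookup∘tabulate; tabulate-cong)
open import Function using (_∘_; id)
open import Function.Bundles using (Equivalence; _⇔_; mk⇔)
open import Relation.Binary.Construct.Closure.ReflexiveTransitive using (ε; _◅_; _◅◅_)
open import Relation.Binary.Construct.Closure.Symmetric using (SymClosure; fwd; bwd)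
open import Relation.Binary.Definitions using (DecidableEquality; tri<; tri≈; tri>)
open import Relation.Binary.PropositionalEquality
open import Relation.Nullary using (¬_; Dec; yes; no)
open import Relation.Nullary.Decidable using (dec-true; dec-false; _×-dec_)
open import Relation.Unary using (Decidable)

open import Defs

≡ᵇ-true⇒≡ : ∀ m k → (m ≡ᵇ k) ≡ true → m ≡ k
≡ᵇ-true⇒≡ m k e = ≡ᵇ⇒≡ m k (subst T (sym e) tt)

≡⇒≡ᵇ-true : ∀ m k → m ≡ k → (m ≡ᵇ k) ≡ true
≡⇒≡ᵇ-true m k e = Equivalence.to T-≡ (≡⇒≡ᵇ m k e)

≡ᵇ-false⇒≢ : ∀ m k → (m ≡ᵇ k) ≡ false → m ≢ k
≡ᵇ-false⇒≢ m k e m≡k = subst T e (≡⇒≡ᵇ m k m≡k)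

≢⇒≡ᵇ-false : ∀ m k → m ≢ k → (m ≡ᵇ k) ≡ false
≢⇒≡ᵇ-false m k m≢k = ¬-not (m≢k ∘ ≡ᵇ-true⇒≡ m k)

<ᵇ-true⇒< : ∀ m k → (m <ᵇ k) ≡ true → m < k
<ᵇ-true⇒< m k e = <ᵇ⇒< m k (subst T (sym e) tt)

<⇒<ᵇ-true : ∀ {m k} → m < k → (m <ᵇ k) ≡ true
<⇒<ᵇ-true m<k = Equivalence.to T-≡ (<⇒<ᵇ m<k)

<ᵇ-false⇒≮ : ∀ {m k} → (m <ᵇ k) ≡ false → ¬ m < k
<ᵇ-false⇒≮ e m<k = subst T e (<⇒<ᵇ m<k)

≮⇒<ᵇ-false : ∀ {m k} → ¬ m < k → (m <ᵇ k) ≡ false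
≮⇒<ᵇ-false m≮k = ¬-not (m≮k ∘ <ᵇ-true⇒< _ _)

module _ {n k : ℕ} {c : Fin n} where

  isVal⇒≡ : isVal k c ≡ true → toℕ c ≡ k
  isVal⇒≡ = ≡ᵇ-true⇒≡ (toℕ c) k

  isVal-false⇒≢ : isVal k c ≡ false → toℕ c ≢ k
  isVal-false⇒≢ = ≡ᵇ-false⇒≢ (toℕ c) k

  ≡⇒isVal : toℕ c ≡ k → isVal k c ≡ true
  ≡⇒isVal = ≡⇒≡ᵇ-true (toℕ c) k

  ≢⇒isVal-false : toℕ c ≢ k → isVal k c ≡ false
  ≢⇒isVal-false = ≢⇒≡ᵇ-false (toℕ c) k

module ℕ-CS = CommutativeSemigroupProperties +-commutativeSemigroup
module ∨-CS = CommutativeSemigroupProperties (CommutativeMonoid.commutativeSemigroup ∨-commutativeMonoid)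

∨-false⁻ : ∀ {x y} → x ∨ y ≡ false → x ≡ false × y ≡ false
∨-false⁻ e = ∨-conicalˡ _ _ e , ∨-conicalʳ _ _ e

∧-false⇒false : ∀ {x y} → y ≡ true → x ∧ y ≡ false → x ≡ false
∧-false⇒false {x} refl x∧true≡false = trans (sym (∧-identityʳ x)) x∧true≡false

n≢1+n : ∀ {k} → k ≢ suc k
n≢1+n = 1+n≢n ∘ sym

nothing≢just : ∀ {A : Set} {x : A} → nothing ≢ just x
nothing≢just ()

map≡just⁻ : ∀ {A B : Set} (f : A → B) (m : Maybe A) {z} → Maybe.map f m ≡ just z → ∃[ a ] (m ≡ just a × f a ≡ z)
map≡just⁻ f (just a) refl = a , refl , refl

∷ʳ-induction : ∀ {A : Set} (P : List A → Set) → P [] → (∀ w a → P w → P (w ∷ʳ a)) → ∀ w → P w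
∷ʳ-induction P base step w = go (reverseView w)
  where
  go : ∀ {w} → Reverse w → P w
  go [] = base
  go (w ∶ r ∶ʳ a) = step w a (go r)

any-++ : ∀ {A : Set} (q : A → Bool) xs ys → any q (xs ++ ys) ≡ any q xs ∨ any q ys
any-++ q [] ys = refl
any-++ q (x ∷ xs) ys = trans (cong (q x ∨_) (any-++ q xs ys)) (sym (∨-assoc (q x) _ _))

module _ {n : ℕ} where

  count-++ : (c : Fin n) (xs ys : Word n) → count c (xs ++ ys) ≡ count c xs + count c ys
  count-++ c [] ys = refl
  count-++ c (x ∷ xs) ys with toℕ x ≡ᵇ toℕ c
  ... | true = cong suc (count-++ c xs ys)
  ... | false = count-++ c xs ys

  QRaux-∷ʳ : (T : QRTab n) (w : Word n) (a : Fin n) → QRaux T (w ∷ʳ a) ≡ insertQR a (QRaux T w)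
  QRaux-∷ʳ T [] a = refl
  QRaux-∷ʳ T (c ∷ w) a = QRaux-∷ʳ (insertQR c T) w a

  QR-∷ʳ : (w : Word n) (a : Fin n) → QR (w ∷ʳ a) ≡ insertQR a (QR w)
  QR-∷ʳ = QRaux-∷ʳ []

  entry : Fin n × Bool → ℕ
  entry c = toℕ (proj₁ c)

  EntryAtMost EntryAbove EntryAtLeast : ℕ → Fin n × Bool → Set
  EntryAtMost m c = entry c ≤ m
  EntryAbove m c = m < entry c
  EntryAtLeast m c = m ≤ entry c

  splitAux-skip : (a x : Fin n) → ∀ b r acc → toℕ a < toℕ x → splitAux a ((x , b) ∷ r) acc ≡ splitAux a r ((x , b) ∷ acc)
  splitAux-skip a x b r acc a<x rewrite dec-false (x ≤? a) (<⇒≱ a<x) = refl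

  splitAux-stop : (a x : Fin n) → ∀ b r acc → toℕ x ≤ toℕ a → splitAux a ((x , b) ∷ r) acc ≡ (reverse ((x , b) ∷ r) , acc)
  splitAux-stop a x b r acc x≤a rewrite dec-true (x ≤? a) x≤a = refl

  splitAux-above : (a : Fin n) (rs r acc : QRTab n) → All (EntryAbove (toℕ a)) rs →
    splitAux a (reverse rs ++ r) acc ≡ splitAux a r (rs ++ acc)
  splitAux-above a rs r acc above = go (reverseView rs) above acc
    where
    open ≡-Reasoning
    go : ∀ {rs} → Reverse rs → All (EntryAbove (toℕ a)) rs → ∀ acc →
      splitAux a (reverse rs ++ r) acc ≡ splitAux a r (rs ++ acc)
    go [] _ acc = refl
    go (rs ∶ view ∶ʳ (x , b)) above acc =
      begin
        splitAux a (reverse (rs ∷ʳ (x , b)) ++ r) acc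
      ≡⟨ cong (λ z → splitAux a (z ++ r) acc) (reverse-++ rs _) ⟩
        splitAux a ((x , b) ∷ reverse rs ++ r) acc
      ≡⟨ splitAux-skip a x b _ acc (proj₂ (∷ʳ⁻ above)) ⟩
        splitAux a (reverse rs ++ r) ((x , b) ∷ acc)
      ≡⟨ go view (proj₁ (∷ʳ⁻ above)) _ ⟩
        splitAux a r (rs ++ (x , b) ∷ acc)
      ≡⟨ cong (splitAux a r) (sym (++-assoc rs _ acc)) ⟩
        splitAux a r ((rs ∷ʳ (x , b)) ++ acc)
      ∎

  splitAux-atMost : (a : Fin n) (p s : QRTab n) → All (EntryAtMost (toℕ a)) p → splitAux a (reverse p) s ≡ (p , s)
  splitAux-atMost a p s = go (reverseView p)
    where
    open ≡-Reasoning
    go : ∀ {p} → Reverse p → All (EntryAtMost (toℕ a)) p → splitAux a (reverse p) s ≡ (p , s)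
    go [] _ = refl
    go (p ∶ _ ∶ʳ (x , b)) atMost =
      begin
        splitAux a (reverse (p ∷ʳ (x , b))) s
      ≡⟨ cong (λ z → splitAux a z s) (reverse-++ p _) ⟩
        splitAux a ((x , b) ∷ reverse p) s
      ≡⟨ splitAux-stop a x b (reverse p) s (proj₂ (∷ʳ⁻ atMost)) ⟩
        (reverse ((x , b) ∷ reverse p) , s)
      ≡⟨ cong (_, s) (trans (unfold-reverse (x , b) (reverse p)) (cong (_∷ʳ (x , b)) (reverse-involutive p))) ⟩
        (p ∷ʳ (x , b) , s)
      ∎

  splitAt≤-++ : (a : Fin n) (p s : QRTab n) → All (EntryAtMost (toℕ a)) p → All (EntryAbove (toℕ a)) s →
    splitAt≤ a (p ++ s) ≡ (p , s)
  splitAt≤-++ a p s atMost above =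
    begin
      splitAux a (reverse (p ++ s)) []
    ≡⟨ cong (λ z → splitAux a z []) (reverse-++ p s) ⟩
      splitAux a (reverse s ++ reverse p) []
    ≡⟨ splitAux-above a s (reverse p) [] above ⟩
      splitAux a (reverse p) (s ++ [])
    ≡⟨ cong (splitAux a (reverse p)) (++-identityʳ s) ⟩
      splitAux a (reverse p) s
    ≡⟨ splitAux-atMost a p s atMost ⟩
      (p , s)
    ∎
    where open ≡-Reasoning

  insertQR-++ : (a : Fin n) (p s : QRTab n) → All (EntryAtMost (toℕ a)) p → All (EntryAbove (toℕ a)) s →
    insertQR a (p ++ s) ≡ p ++ (a , false) ∷ attachBelow s
  insertQR-++ a p s atMost above rewrite splitAt≤-++ a p s atMost above = refl

  Sorted : QRTab n → Set
  Sorted = AllPairs (λ c d → entry c ≤ entry d)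

  -- A cell may start a new row only below a cell with a different, hence smaller, entry.
  FlagAllowed : Maybe (Fin n) → Fin n → Bool → Set
  FlagAllowed nothing x below = below ≡ false
  FlagAllowed (just y) x below = toℕ y ≡ toℕ x → below ≡ false

  ColumnStrict : Maybe (Fin n) → QRTab n → Set
  ColumnStrict _ [] = ⊤
  ColumnStrict m ((x , below) ∷ t) = FlagAllowed m x below × ColumnStrict (just x) t

  IsQRTableau : QRTab n → Set
  IsQRTableau T = Sorted T × ColumnStrict nothing T

  sorted-split : (a : Fin n) (T : QRTab n) → Sorted T →
    ∃[ p ] ∃[ s ] (T ≡ p ++ s × All (EntryAtMost (toℕ a)) p × All (EntryAbove (toℕ a)) s)
  sorted-split a [] _ = [] , [] , refl , [] , []
  sorted-split a ((x , b) ∷ t) (x≤t ∷ sorted) with x ≤? a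
  ... | yes x≤a with sorted-split a t sorted
  ...   | p , s , refl , atMost , above = (x , b) ∷ p , s , refl , x≤a ∷ atMost , above
  sorted-split a ((x , b) ∷ t) (x≤t ∷ _) | no x≰a =
    [] , (x , b) ∷ t , refl , [] , ≰⇒> x≰a ∷ All.map (<-≤-trans (≰⇒> x≰a)) x≤t

  All-attachBelow : {P : Fin n × Bool → Set} → (∀ {x b} → P (x , b) → P (x , true)) →
    ∀ {s} → All P s → All P (attachBelow s)
  All-attachBelow keep [] = []
  All-attachBelow keep (p ∷ ps) = keep p ∷ ps

  Sorted-attachBelow : ∀ {s} → Sorted s → Sorted (attachBelow s)
  Sorted-attachBelow [] = []
  Sorted-attachBelow (p ∷ ps) = p ∷ ps

  Sorted-insert : (a : Fin n) (p s : QRTab n) → Sorted (p ++ s) →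
    All (EntryAtMost (toℕ a)) p → All (EntryAbove (toℕ a)) s → Sorted (p ++ (a , false) ∷ attachBelow s)
  Sorted-insert a [] s sorted [] above = All-attachBelow id (All.map <⇒≤ above) ∷ Sorted-attachBelow sorted
  Sorted-insert a (c ∷ p) s (c≤ ∷ sorted) (c≤a ∷ atMost) above =
    All-++⁺ (++⁻ˡ p c≤) (c≤a ∷ All-attachBelow id (++⁻ʳ p c≤)) ∷ Sorted-insert a p s sorted atMost above

  FlagAllowed-false : ∀ m (x : Fin n) → FlagAllowed m x false
  FlagAllowed-false nothing x = refl
  FlagAllowed-false (just y) x _ = refl

  ColumnStrict-attachBelow : ∀ {m} (a : Fin n) s → ColumnStrict m s → All (EntryAbove (toℕ a)) s →
    ColumnStrict (just a) (attachBelow s)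
  ColumnStrict-attachBelow a [] _ _ = tt
  ColumnStrict-attachBelow a ((x , b) ∷ s) (_ , cs) (a<x ∷ _) = (λ a≡x → ⊥-elim (<-irrefl a≡x a<x)) , cs

  ColumnStrict-insert : (a : Fin n) (m : Maybe (Fin n)) (p s : QRTab n) → ColumnStrict m (p ++ s) →
    All (EntryAtMost (toℕ a)) p → All (EntryAbove (toℕ a)) s → ColumnStrict m (p ++ (a , false) ∷ attachBelow s)
  ColumnStrict-insert a m [] s cs [] above = FlagAllowed-false m a , ColumnStrict-attachBelow a s cs above
  ColumnStrict-insert a m ((x , b) ∷ p) s (ok , cs) (_ ∷ atMost) above =
    ok , ColumnStrict-insert a (just x) p s cs atMost above

  insertQR-IsQRTableau : (a : Fin n) (T : QRTab n) → IsQRTableau T → IsQRTableau (insertQR a T)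
  insertQR-IsQRTableau a T (sorted , cs) with sorted-split a T sorted
  ... | p , s , refl , atMost , above rewrite insertQR-++ a p s atMost above =
    Sorted-insert a p s sorted atMost above , ColumnStrict-insert a nothing p s cs atMost above

  QR-IsQRTableau : (w : Word n) → IsQRTableau (QR w)
  QR-IsQRTableau = ∷ʳ-induction (IsQRTableau ∘ QR) ([] , tt)
    (λ w a t → subst IsQRTableau (sym (QR-∷ʳ w a)) (insertQR-IsQRTableau a (QR w) t))

  QR-sorted : (w : Word n) → Sorted (QR w)
  QR-sorted w = proj₁ (QR-IsQRTableau w)

  content : QRTab n → Word n
  content = map proj₁

  content-++ : (p s : QRTab n) → content (p ++ s) ≡ content p ++ content s
  content-++ = map-++ proj₁

  content-attachBelow : (s : QRTab n) → content (attachBelow s) ≡ content s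
  content-attachBelow [] = refl
  content-attachBelow (_ ∷ _) = refl

  content-insert : (a : Fin n) (p s : QRTab n) → content (p ++ (a , false) ∷ attachBelow s) ≡ content p ++ a ∷ content s
  content-insert a p s = trans (content-++ p _) (cong (λ z → content p ++ a ∷ z) (content-attachBelow s))

  insertQR-content : (a : Fin n) (T : QRTab n) → Sorted T →
    ∃[ p ] ∃[ s ] (content T ≡ p ++ s × content (insertQR a T) ≡ p ++ a ∷ s)
  insertQR-content a T sorted with sorted-split a T sorted
  ... | p , s , refl , atMost , above rewrite insertQR-++ a p s atMost above =
    content p , content s , content-++ p s , content-insert a p s

  count-QR : (c : Fin n) (w : Word n) → count c (content (QR w)) ≡ count c w
  count-QR c = ∷ʳ-induction (λ w → count c (content (QR w)) ≡ count c w) refl step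
    where
    open ≡-Reasoning
    step : ∀ w a → count c (content (QR w)) ≡ count c w → count c (content (QR (w ∷ʳ a))) ≡ count c (w ∷ʳ a)
    step w a ih with insertQR-content a (QR w) (QR-sorted w)
    ... | p , s , before , after =
      begin
        count c (content (QR (w ∷ʳ a)))
      ≡⟨ cong (count c ∘ content) (QR-∷ʳ w a) ⟩
        count c (content (insertQR a (QR w)))
      ≡⟨ cong (count c) after ⟩
        count c (p ++ a ∷ s)
      ≡⟨ count-++ c p ((a ∷ []) ++ s) ⟩
        count c p + count c ((a ∷ []) ++ s)
      ≡⟨ cong (count c p +_) (count-++ c (a ∷ []) s) ⟩
        count c p + (count c (a ∷ []) + count c s)
      ≡⟨ ℕ-CS.x∙yz≈xz∙y (count c p) _ _ ⟩
        count c p + count c s + count c (a ∷ [])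
      ≡⟨ cong (_+ count c (a ∷ [])) (trans (sym (count-++ c p s)) (trans (cong (count c) (sym before)) ih)) ⟩
        count c w + count c (a ∷ [])
      ≡⟨ sym (count-++ c w (a ∷ [])) ⟩
        count c (w ∷ʳ a)
      ∎

  any-QR : (q : Fin n → Bool) (w : Word n) → any q (content (QR w)) ≡ any q w
  any-QR q = ∷ʳ-induction (λ w → any q (content (QR w)) ≡ any q w) refl step
    where
    open ≡-Reasoning
    step : ∀ w a → any q (content (QR w)) ≡ any q w → any q (content (QR (w ∷ʳ a))) ≡ any q (w ∷ʳ a)
    step w a ih with insertQR-content a (QR w) (QR-sorted w)
    ... | p , s , before , after =
      begin
        any q (content (QR (w ∷ʳ a)))
      ≡⟨ cong (any q ∘ content) (QR-∷ʳ w a) ⟩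
        any q (content (insertQR a (QR w)))
      ≡⟨ cong (any q) after ⟩
        any q (p ++ a ∷ s)
      ≡⟨ any-++ q p ((a ∷ []) ++ s) ⟩
        any q p ∨ any q ((a ∷ []) ++ s)
      ≡⟨ cong (any q p ∨_) (any-++ q (a ∷ []) s) ⟩
        any q p ∨ (any q (a ∷ []) ∨ any q s)
      ≡⟨ ∨-CS.x∙yz≈xz∙y (any q p) _ _ ⟩
        (any q p ∨ any q s) ∨ any q (a ∷ [])
      ≡⟨ cong (_∨ any q (a ∷ [])) (trans (sym (any-++ q p s)) (trans (cong (any q) (sym before)) ih)) ⟩
        any q w ∨ any q (a ∷ [])
      ≡⟨ sym (any-++ q w (a ∷ [])) ⟩
        any q (w ∷ʳ a)
      ∎

module _ {n : ℕ} where

  firstFlag : (Fin n → Bool) → QRTab n → Bool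
  firstFlag q [] = false
  firstFlag q ((x , below) ∷ t) = if q x then below else firstFlag q t

  -- Along the ribbon all letters k precede all letters k+1, so a word has a k-inversion exactly when
  -- its tableau contains k and its first k+1 starts a new row.
  hasInvᵀ : ℕ → QRTab n → Bool
  hasInvᵀ k T = any (isVal k) (content T) ∧ firstFlag (isVal (suc k)) T

  replaceLastStep : (Fin n → Bool) → Fin n → Fin n → Bool → QRTab n → Maybe (QRTab n) → Maybe (QRTab n)
  replaceLastStep q b x below t (just t') = just ((x , below) ∷ t')
  replaceLastStep q b x below t nothing = if q x then just ((b , below) ∷ t) else nothing

  replaceLastᵀ : (Fin n → Bool) → Fin n → QRTab n → Maybe (QRTab n)
  replaceLastᵀ q b [] = nothing
  replaceLastᵀ q b ((x , below) ∷ t) = replaceLastStep q b x below t (replaceLastᵀ q b t)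

  replaceFirstᵀ : (Fin n → Bool) → Fin n → QRTab n → Maybe (QRTab n)
  replaceFirstᵀ q b [] = nothing
  replaceFirstᵀ q b ((x , below) ∷ t) =
    if q x then just ((b , below) ∷ t) else Maybe.map ((x , below) ∷_) (replaceFirstᵀ q b t)

  fᵀ : (k : ℕ) → suc k < n → QRTab n → Maybe (QRTab n)
  fᵀ k h T = if hasInvᵀ k T then nothing else replaceLastᵀ (isVal k) (fromℕ< h) T

  eᵀ : (k : ℕ) → suc k < n → QRTab n → Maybe (QRTab n)
  eᵀ k h T = if hasInvᵀ k T then nothing else replaceFirstᵀ (isVal (suc k)) (fromℕ< (<-trans (n<1+n k) h)) T

  firstFlag-++ : (q : Fin n → Bool) (p r : QRTab n) →
    firstFlag q (p ++ r) ≡ (if any q (content p) then firstFlag q p else firstFlag q r)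
  firstFlag-++ q [] r = refl
  firstFlag-++ q ((x , below) ∷ p) r with q x
  ... | true = refl
  ... | false = firstFlag-++ q p r

  firstFlag-absent : (q : Fin n → Bool) (s : QRTab n) → any q (content s) ≡ false → firstFlag q s ≡ false
  firstFlag-absent q [] _ = refl
  firstFlag-absent q ((x , below) ∷ s) none with q x
  ... | false = firstFlag-absent q s none

  EntryNot : ℕ → Fin n × Bool → Set
  EntryNot j c = entry c ≢ j

  atMost⇒EntryNot : ∀ {m j} → m < j → {P : QRTab n} → All (EntryAtMost m) P → All (EntryNot j) P
  atMost⇒EntryNot m<j = All.map (λ c≤m c≡j → <-irrefl c≡j (≤-<-trans c≤m m<j))

  atLeast⇒EntryNot : ∀ {m j} → j < m → {S : QRTab n} → All (EntryAtLeast m) S → All (EntryNot j) S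
  atLeast⇒EntryNot j<m = All.map (λ m≤c c≡j → <-irrefl (sym c≡j) (<-≤-trans j<m m≤c))

  absent⇒any-isVal-false : (j : ℕ) (T : QRTab n) → All (EntryNot j) T → any (isVal j) (content T) ≡ false
  absent⇒any-isVal-false j [] [] = refl
  absent⇒any-isVal-false j ((x , _) ∷ T) (x≢j ∷ avoids)
    rewrite ≢⇒isVal-false {k = j} {c = x} x≢j = absent⇒any-isVal-false j T avoids

  any-isVal-atMost : ∀ {m} (p : QRTab n) (j : ℕ) → All (EntryAtMost m) p → m < j → any (isVal j) (content p) ≡ false
  any-isVal-atMost p j atMost m<j = absent⇒any-isVal-false j p (atMost⇒EntryNot m<j atMost)

  any-isVal-atLeast : ∀ {m} (s : QRTab n) (j : ℕ) → All (EntryAtLeast m) s → j < m → any (isVal j) (content s) ≡ false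
  any-isVal-atLeast s j atLeast j<m = absent⇒any-isVal-false j s (atLeast⇒EntryNot j<m atLeast)

  any-isVal-above : ∀ {m} (s : QRTab n) (j : ℕ) → All (EntryAbove m) s → j ≤ m → any (isVal j) (content s) ≡ false
  any-isVal-above s j above j≤m = any-isVal-atLeast s j above (s≤s j≤m)

  any-isVal⇒∃ : (P : Fin n × Bool → Set) (s : QRTab n) (j : ℕ) → All P s → any (isVal j) (content s) ≡ true →
    ∃[ c ] (P c × entry c ≡ j)
  any-isVal⇒∃ P ((x , b) ∷ s) j (px ∷ ps) present with isVal j x in x≡j
  ... | true = (x , b) , px , isVal⇒≡ x≡j
  ... | false = any-isVal⇒∃ P s j ps present

  Sorted-++⁻ʳ : (p : QRTab n) {s : QRTab n} → Sorted (p ++ s) → Sorted s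
  Sorted-++⁻ʳ [] sorted = sorted
  Sorted-++⁻ʳ (_ ∷ p) (_ ∷ sorted) = Sorted-++⁻ʳ p sorted

  hasInvᵀ-insert : (k : ℕ) (a : Fin n) (T : QRTab n) → Sorted T →
    hasInvᵀ k (insertQR a T) ≡ hasInvᵀ k T ∨ (isVal k a ∧ any (isVal (suc k)) (content T))
  hasInvᵀ-insert k a T sorted with sorted-split a T sorted
  ... | p , s , refl , atMost , above rewrite insertQR-++ a p s atMost above =
    go s (Sorted-++⁻ʳ p sorted) above
    where
    -- Only the cell following the new cell a changes its flag, and this matters only when p contains
    -- no k+1 and that cell is k+1.
    go : (s : QRTab n) → Sorted s → All (EntryAbove (toℕ a)) s →
      any (isVal k) (content (p ++ (a , false) ∷ attachBelow s)) ∧ firstFlag (isVal (suc k)) (p ++ (a , false) ∷ attachBelow s)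
      ≡ (any (isVal k) (content (p ++ s)) ∧ firstFlag (isVal (suc k)) (p ++ s))
        ∨ (isVal k a ∧ any (isVal (suc k)) (content (p ++ s)))
    go s _ above
      rewrite content-insert a p s | content-++ p s
            | any-++ (isVal k) (content p) (a ∷ content s) | any-++ (isVal k) (content p) (content s)
            | any-++ (isVal (suc k)) (content p) (content s)
            | firstFlag-++ (isVal (suc k)) p ((a , false) ∷ attachBelow s) | firstFlag-++ (isVal (suc k)) p s
      with any (isVal (suc k)) (content p) in p-has-k+1
    ... | true with any-isVal⇒∃ (EntryAtMost (toℕ a)) p (suc k) atMost p-has-k+1
    ...   | c , c≤a , c≡k+1
      rewrite ≢⇒isVal-false {k = k} {c = a} (λ a≡k → <-irrefl (sym a≡k) (subst (_≤ toℕ a) c≡k+1 c≤a))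
      = sym (∨-identityʳ _)
    go s _ above | false with isVal (suc k) a in a≡k+1
    ... | true
      rewrite ≢⇒isVal-false {k = k} {c = a} (λ a≡k → n≢1+n (trans (sym a≡k) (isVal⇒≡ a≡k+1)))
            | any-isVal-above s k above (subst (k ≤_) (sym (isVal⇒≡ a≡k+1)) (n≤1+n k))
            | firstFlag-absent (isVal (suc k)) s (any-isVal-above s (suc k) above (≤-reflexive (sym (isVal⇒≡ a≡k+1))))
      = trans (∧-zeroʳ _) (sym (trans (∨-identityʳ _) (∧-zeroʳ _)))
    go [] _ _ | false | false =
      trans (∧-zeroʳ _) (sym (trans (cong (_∨ (isVal k a ∧ false)) (∧-zeroʳ (any (isVal k) (content p) ∨ false)))
                                    (∧-zeroʳ (isVal k a))))
    go ((x , b) ∷ s) (x≤s ∷ _) (a<x ∷ _) | false | false with isVal (suc k) x in x≡k+1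
    ... | true with isVal k a in a≡k
    ...   | true rewrite ≢⇒isVal-false {k = k} {c = x} (λ x≡k → n≢1+n (trans (sym x≡k) (isVal⇒≡ x≡k+1)))
      = trans (∧-identityʳ _) (trans (∨-zeroʳ _) (sym (∨-zeroʳ _)))
    ...   | false
      rewrite ≢⇒isVal-false {k = k} {c = x} (λ x≡k → n≢1+n (trans (sym x≡k) (isVal⇒≡ x≡k+1)))
            | any-isVal-atMost p k atMost (≤∧≢⇒< (s≤s⁻¹ (subst (toℕ a <_) (isVal⇒≡ x≡k+1) a<x)) (isVal-false⇒≢ a≡k))
            | any-isVal-atLeast s k x≤s (subst (k <_) (sym (isVal⇒≡ x≡k+1)) (n<1+n k))
      = refl
    go ((x , b) ∷ s) (x≤s ∷ _) (a<x ∷ _) | false | false | false with isVal k a in a≡k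
    ... | true with any-isVal-atLeast s (suc k) x≤s
                     (≤∧≢⇒< (subst (_< toℕ x) (isVal⇒≡ a≡k) a<x) (λ k+1≡x → isVal-false⇒≢ x≡k+1 (sym k+1≡x)))
    ...   | s-lacks-k+1 rewrite s-lacks-k+1 | firstFlag-absent (isVal (suc k)) s s-lacks-k+1
      = trans (∧-zeroʳ _) (sym (cong (_∨ false) (∧-zeroʳ _)))
    go ((x , b) ∷ s) _ _ | false | false | false | false = sym (∨-identityʳ _)

hasInv-∷ʳ : ∀ {n} k (w : Word n) a → hasInv k (w ∷ʳ a) ≡ hasInv k w ∨ (isVal k a ∧ any (isVal (suc k)) w)
hasInv-∷ʳ k [] a rewrite ∧-zeroʳ (isVal (suc k) a) | ∧-zeroʳ (isVal k a) = refl
hasInv-∷ʳ k (c ∷ w) a rewrite any-++ (isVal k) w (a ∷ []) | hasInv-∷ʳ k w a =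
  shuffle (isVal (suc k) c) (any (isVal k) w) (isVal k a) (hasInv k w) (any (isVal (suc k)) w)
  where
  shuffle : ∀ x y z h a → (x ∧ (y ∨ (z ∨ false))) ∨ (h ∨ (z ∧ a)) ≡ ((x ∧ y) ∨ h) ∨ (z ∧ (x ∨ a))
  shuffle false y z h a = refl
  shuffle true true z h a = refl
  shuffle true false false h a = refl
  shuffle true false true h a = sym (∨-zeroʳ h)

hasInv≡hasInvᵀ∘QR : ∀ {n} k (w : Word n) → hasInv k w ≡ hasInvᵀ k (QR w)
hasInv≡hasInvᵀ∘QR {n} k = ∷ʳ-induction (λ w → hasInv k w ≡ hasInvᵀ k (QR w)) refl step
  where
  step : ∀ (w : Word n) a → hasInv k w ≡ hasInvᵀ k (QR w) → hasInv k (w ∷ʳ a) ≡ hasInvᵀ k (QR (w ∷ʳ a))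
  step w a ih rewrite QR-∷ʳ w a | hasInvᵀ-insert k a (QR w) (QR-sorted w) | hasInv-∷ʳ k w a | ih
    | any-QR (isVal (suc k)) w = refl

module _ {n : ℕ} where

  replaceLast-∷ʳ : (q : Fin n → Bool) (b : Fin n) (w : Word n) (a : Fin n) →
    replaceLast q b (w ∷ʳ a) ≡ (if q a then just (w ∷ʳ b) else Maybe.map (_∷ʳ a) (replaceLast q b w))
  replaceLast-∷ʳ q b [] a with q a
  ... | true = refl
  ... | false = refl
  replaceLast-∷ʳ q b (c ∷ w) a rewrite replaceLast-∷ʳ q b w a with q a
  ... | true = refl
  ... | false with replaceLast q b w
  ...   | just _ = refl
  ...   | nothing with q c
  ...     | true = refl
  ...     | false = refl

  replaceFirst-∷ʳ-result : (q : Fin n → Bool) (b : Fin n) (w : Word n) (a : Fin n) → Maybe (Word n) → Maybe (Word n)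
  replaceFirst-∷ʳ-result q b w a (just w') = just (w' ∷ʳ a)
  replaceFirst-∷ʳ-result q b w a nothing = if q a then just (w ∷ʳ b) else nothing

  replaceFirst-∷ʳ : (q : Fin n → Bool) (b : Fin n) (w : Word n) (a : Fin n) →
    replaceFirst q b (w ∷ʳ a) ≡ replaceFirst-∷ʳ-result q b w a (replaceFirst q b w)
  replaceFirst-∷ʳ q b [] a with q a
  ... | true = refl
  ... | false = refl
  replaceFirst-∷ʳ q b (c ∷ w) a with q c
  ... | true = refl
  ... | false rewrite replaceFirst-∷ʳ q b w a with replaceFirst q b w
  ...   | just _ = refl
  ...   | nothing with q a
  ...     | true = refl
  ...     | false = refl

  replaceLast-absent : (q : Fin n → Bool) (b : Fin n) (u : Word n) → any q u ≡ false → replaceLast q b u ≡ nothing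
  replaceLast-absent q b [] _ = refl
  replaceLast-absent q b (c ∷ u) none
    rewrite replaceLast-absent q b u (proj₂ (∨-false⁻ none)) | proj₁ (∨-false⁻ {q c} none) = refl

  replaceLast-nothing⇒absent : (q : Fin n → Bool) (b : Fin n) (u : Word n) → replaceLast q b u ≡ nothing → any q u ≡ false
  replaceLast-nothing⇒absent q b [] _ = refl
  replaceLast-nothing⇒absent q b (c ∷ u) e with replaceLast q b u in e'
  ... | nothing with q c
  ...   | false = replaceLast-nothing⇒absent q b u e'

  replaceLast-just⇒present : (q : Fin n → Bool) (b : Fin n) (u u' : Word n) → replaceLast q b u ≡ just u' → any q u ≡ true
  replaceLast-just⇒present q b u u' u↦ with any q u in has
  ... | true = refl
  ... | false = ⊥-elim (nothing≢just (trans (sym (replaceLast-absent q b u has)) u↦))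

  replaceFirst-nothing⇒absent : (q : Fin n → Bool) (b : Fin n) (w : Word n) → replaceFirst q b w ≡ nothing → any q w ≡ false
  replaceFirst-nothing⇒absent q b [] _ = refl
  replaceFirst-nothing⇒absent q b (c ∷ w) e with q c
  ... | false with replaceFirst q b w in e'
  ...   | nothing = replaceFirst-nothing⇒absent q b w e'

  replaceFirst-just⇒present : (q : Fin n → Bool) (b : Fin n) (w w' : Word n) → replaceFirst q b w ≡ just w' → any q w ≡ true
  replaceFirst-just⇒present q b (c ∷ w) w' e with q c
  ... | true = refl
  ... | false with replaceFirst q b w in e'
  ...   | just u = replaceFirst-just⇒present q b w u e'

  replaceLastᵀ-++-result : (q : Fin n → Bool) (b : Fin n) (p r : QRTab n) → Maybe (QRTab n) → Maybe (QRTab n)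
  replaceLastᵀ-++-result q b p r (just r') = just (p ++ r')
  replaceLastᵀ-++-result q b p r nothing = Maybe.map (_++ r) (replaceLastᵀ q b p)

  replaceLastᵀ-++ : (q : Fin n → Bool) (b : Fin n) (p r : QRTab n) →
    replaceLastᵀ q b (p ++ r) ≡ replaceLastᵀ-++-result q b p r (replaceLastᵀ q b r)
  replaceLastᵀ-++ q b [] r with replaceLastᵀ q b r
  ... | just _ = refl
  ... | nothing = refl
  replaceLastᵀ-++ q b ((x , below) ∷ p) r rewrite replaceLastᵀ-++ q b p r with replaceLastᵀ q b r
  ... | just _ = refl
  ... | nothing with replaceLastᵀ q b p
  ...   | just _ = refl
  ...   | nothing with q x
  ...     | true = refl
  ...     | false = refl

  replaceFirstᵀ-++-result : (q : Fin n → Bool) (b : Fin n) (p r : QRTab n) → Maybe (QRTab n) → Maybe (QRTab n)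
  replaceFirstᵀ-++-result q b p r (just p') = just (p' ++ r)
  replaceFirstᵀ-++-result q b p r nothing = Maybe.map (p ++_) (replaceFirstᵀ q b r)

  replaceFirstᵀ-++ : (q : Fin n → Bool) (b : Fin n) (p r : QRTab n) →
    replaceFirstᵀ q b (p ++ r) ≡ replaceFirstᵀ-++-result q b p r (replaceFirstᵀ q b p)
  replaceFirstᵀ-++ q b [] r with replaceFirstᵀ q b r
  ... | just _ = refl
  ... | nothing = refl
  replaceFirstᵀ-++ q b ((x , below) ∷ p) r with q x
  ... | true = refl
  ... | false rewrite replaceFirstᵀ-++ q b p r with replaceFirstᵀ q b p
  ...   | just _ = refl
  ...   | nothing with replaceFirstᵀ q b r
  ...     | just _ = refl
  ...     | nothing = refl

  replaceLastᵀ-attachBelow : (q : Fin n → Bool) (b : Fin n) (s : QRTab n) →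
    replaceLastᵀ q b (attachBelow s) ≡ Maybe.map attachBelow (replaceLastᵀ q b s)
  replaceLastᵀ-attachBelow q b [] = refl
  replaceLastᵀ-attachBelow q b ((x , _) ∷ t) with replaceLastᵀ q b t
  ... | just _ = refl
  ... | nothing with q x
  ...   | true = refl
  ...   | false = refl

  replaceFirstᵀ-attachBelow : (q : Fin n → Bool) (b : Fin n) (s : QRTab n) →
    replaceFirstᵀ q b (attachBelow s) ≡ Maybe.map attachBelow (replaceFirstᵀ q b s)
  replaceFirstᵀ-attachBelow q b [] = refl
  replaceFirstᵀ-attachBelow q b ((x , _) ∷ t) with q x
  ... | true = refl
  ... | false with replaceFirstᵀ q b t
  ...   | just _ = refl
  ...   | nothing = refl

  replaceLastᵀ-absent : (q : Fin n → Bool) (b : Fin n) (s : QRTab n) → any q (content s) ≡ false → replaceLastᵀ q b s ≡ nothing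
  replaceLastᵀ-absent q b [] _ = refl
  replaceLastᵀ-absent q b ((x , _) ∷ t) none
    rewrite replaceLastᵀ-absent q b t (proj₂ (∨-false⁻ none)) | proj₁ (∨-false⁻ {q x} none) = refl

  replaceFirstᵀ-absent : (q : Fin n → Bool) (b : Fin n) (s : QRTab n) → any q (content s) ≡ false → replaceFirstᵀ q b s ≡ nothing
  replaceFirstᵀ-absent q b [] _ = refl
  replaceFirstᵀ-absent q b ((x , _) ∷ t) none
    rewrite replaceFirstᵀ-absent q b t (proj₂ (∨-false⁻ none)) | proj₁ (∨-false⁻ {q x} none) = refl

  replaceLastᵀ-All : (q : Fin n → Bool) (b : Fin n) {P : Fin n × Bool → Set} (s s' : QRTab n) →
    replaceLastᵀ q b s ≡ just s' → All P s → (∀ x below → q x ≡ true → P (x , below) → P (b , below)) → All P s'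
  replaceLastᵀ-All q b ((x , below) ∷ t) s' e (px ∷ ps) keep with replaceLastᵀ q b t in e'
  replaceLastᵀ-All q b ((x , below) ∷ t) _ refl (px ∷ ps) keep | just t' = px ∷ replaceLastᵀ-All q b t t' e' ps keep
  ... | nothing with q x in qx
  replaceLastᵀ-All q b ((x , below) ∷ t) _ refl (px ∷ ps) keep | nothing | true = keep x below qx px ∷ ps

  replaceFirstᵀ-All : (q : Fin n → Bool) (b : Fin n) {P : Fin n × Bool → Set} (s s' : QRTab n) →
    replaceFirstᵀ q b s ≡ just s' → All P s → (∀ x below → q x ≡ true → P (x , below) → P (b , below)) → All P s'
  replaceFirstᵀ-All q b ((x , below) ∷ t) s' e (px ∷ ps) keep with q x in qx
  replaceFirstᵀ-All q b ((x , below) ∷ t) _ refl (px ∷ ps) keep | true = keep x below qx px ∷ ps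
  ... | false with replaceFirstᵀ q b t in e'
  replaceFirstᵀ-All q b ((x , below) ∷ t) _ refl (px ∷ ps) keep | false | just t' = px ∷ replaceFirstᵀ-All q b t t' e' ps keep

  All-weaken-absent : {P Q : Fin n × Bool → Set} (j : ℕ) (s : QRTab n) → All P s → any (isVal j) (content s) ≡ false →
    (∀ c → P c → entry c ≢ j → Q c) → All Q s
  All-weaken-absent j [] [] _ _ = []
  All-weaken-absent j ((x , b) ∷ t) (px ∷ ps) none weaken =
    weaken (x , b) px (isVal-false⇒≢ (proj₁ (∨-false⁻ none))) ∷ All-weaken-absent j t ps (proj₂ (∨-false⁻ none)) weaken

QR-split-absent : ∀ {n} (j : ℕ) (w : Word n) (p s : QRTab n) → QR w ≡ p ++ s → any (isVal j) w ≡ false →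
  any (isVal j) (content p) ≡ false × any (isVal j) (content s) ≡ false
QR-split-absent j w p s QRw≡ps none = ∨-false⁻ (begin
  any (isVal j) (content p) ∨ any (isVal j) (content s) ≡⟨ sym (any-++ (isVal j) (content p) (content s)) ⟩
  any (isVal j) (content p ++ content s)               ≡⟨ cong (any (isVal j)) (sym (content-++ p s)) ⟩
  any (isVal j) (content (p ++ s))                     ≡⟨ cong (any (isVal j) ∘ content) (sym QRw≡ps) ⟩
  any (isVal j) (content (QR w))                       ≡⟨ any-QR (isVal j) w ⟩
  any (isVal j) w                                      ≡⟨ none ⟩
  false                                                ∎)
  where open ≡-Reasoning

QR-replaceLast : ∀ {n} k (b : Fin n) → toℕ b ≡ suc k → (w : Word n) → hasInv k w ≡ false →
  Maybe.map QR (replaceLast (isVal k) b w) ≡ replaceLastᵀ (isVal k) b (QR w)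
QR-replaceLast {n} k b b≡k+1 = ∷ʳ-induction P (λ _ → refl) step
  where
  q : Fin n → Bool
  q = isVal k
  P : Word n → Set
  P w = hasInv k w ≡ false → Maybe.map QR (replaceLast q b w) ≡ replaceLastᵀ q b (QR w)

  raise-atMost : (a : Fin n) → q a ≡ true → ∀ (c : Fin n × Bool) → EntryAtMost (toℕ a) c → EntryAtMost (toℕ b) c
  raise-atMost a a≡k c c≤a = ≤-trans c≤a (subst₂ _≤_ (sym (isVal⇒≡ {c = a} a≡k)) (sym b≡k+1) (n≤1+n k))

  raise-above : (a : Fin n) → q a ≡ true → ∀ (c : Fin n × Bool) → EntryAbove (toℕ a) c → entry c ≢ suc k → EntryAbove (toℕ b) c
  raise-above a a≡k c a<c c≢k+1 =
    subst (_< entry c) (sym b≡k+1) (≤∧≢⇒< (subst (_< entry c) (isVal⇒≡ {c = a} a≡k) a<c) (c≢k+1 ∘ sym))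

  replaced-above : (a : Fin n) → ∀ x below → q x ≡ true → EntryAbove (toℕ a) (x , below) → EntryAbove (toℕ a) (b , below)
  replaced-above a x _ x≡k a<x =
    subst (toℕ a <_) (sym b≡k+1) (≤-trans a<x (≤-trans (≤-reflexive (isVal⇒≡ {c = x} x≡k)) (n≤1+n k)))

  replaced-atMost : (a : Fin n) → q a ≡ false → ∀ x below → q x ≡ true →
    EntryAtMost (toℕ a) (x , below) → EntryAtMost (toℕ a) (b , below)
  replaced-atMost a a≢k x _ x≡k x≤a =
    subst (_≤ toℕ a) (sym b≡k+1)
      (≤∧≢⇒< (subst (_≤ toℕ a) (isVal⇒≡ {c = x} x≡k) x≤a) (λ k≡a → isVal-false⇒≢ {c = a} a≢k (sym k≡a)))

  step : ∀ w a → P w → P (w ∷ʳ a)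
  step w a ih no-inv with ∨-false⁻ {hasInv k w} (trans (sym (hasInv-∷ʳ k w a)) no-inv)
                        | sorted-split a (QR w) (QR-sorted w)
  ... | no-inv-w , no-late-k | p , s , QRw≡ps , atMost , above rewrite replaceLast-∷ʳ q b w a with q a in a≡k
  ... | true
    rewrite QR-∷ʳ w a | QR-∷ʳ w b | QRw≡ps | insertQR-++ a p s atMost above
          | insertQR-++ b p s (All.map (λ {c} → raise-atMost a a≡k c) atMost)
              (All-weaken-absent (suc k) s above (proj₂ (QR-split-absent (suc k) w p s QRw≡ps no-late-k))
                (raise-above a a≡k))
          | replaceLastᵀ-++ q b p ((a , false) ∷ attachBelow s)
          | replaceLastᵀ-attachBelow q b s
          | replaceLastᵀ-absent q b s (any-isVal-above s k above (≤-reflexive (sym (isVal⇒≡ {c = a} a≡k))))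
          | a≡k = refl
  ... | false with replaceLast q b w in w↦ | ih no-inv-w
  ...   | nothing | _ = sym (replaceLastᵀ-absent q b (QR (w ∷ʳ a)) (begin
    any q (content (QR (w ∷ʳ a))) ≡⟨ any-QR q (w ∷ʳ a) ⟩
    any q (w ∷ʳ a)                ≡⟨ any-++ q w (a ∷ []) ⟩
    any q w ∨ (q a ∨ false)       ≡⟨ cong₂ (λ x y → x ∨ (y ∨ false)) (replaceLast-nothing⇒absent q b w w↦) a≡k ⟩
    false                         ∎))
    where open ≡-Reasoning
  ...   | just w' | QRw'≡ rewrite QR-∷ʳ w a | QR-∷ʳ w' a | QRw≡ps | insertQR-++ a p s atMost above
          | replaceLastᵀ-++ q b p ((a , false) ∷ attachBelow s) | replaceLastᵀ-attachBelow q b s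
          = go (replaceLastᵀ q b s) refl
    where
    QRw'≡split : just (QR w') ≡ replaceLastᵀ-++-result q b p s (replaceLastᵀ q b s)
    QRw'≡split = trans QRw'≡ (replaceLastᵀ-++ q b p s)
    go : ∀ r → replaceLastᵀ q b s ≡ r → just (insertQR a (QR w')) ≡
      replaceLastᵀ-++-result q b p ((a , false) ∷ attachBelow s)
        (replaceLastStep q b a false (attachBelow s) (Maybe.map attachBelow r))
    go (just s') s↦s' rewrite just-injective (trans QRw'≡split (cong (replaceLastᵀ-++-result q b p s) s↦s'))
      | insertQR-++ a p s' atMost (replaceLastᵀ-All q b s s' s↦s' above (replaced-above a)) = refl
    go nothing s↦ rewrite a≡k with replaceLastᵀ q b p in p↦
    ... | nothing = ⊥-elim (nothing≢just (sym (trans QRw'≡split (trans (cong (replaceLastᵀ-++-result q b p s) s↦)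
                      (cong (Maybe.map (_++ s)) p↦)))))
    ... | just p' rewrite just-injective (trans QRw'≡split (trans (cong (replaceLastᵀ-++-result q b p s) s↦)
                      (cong (Maybe.map (_++ s)) p↦)))
      | insertQR-++ a p' s (replaceLastᵀ-All q b p p' p↦ atMost (replaced-atMost a a≡k)) above = refl

QR-replaceFirst : ∀ {n} k (b : Fin n) → toℕ b ≡ k → (w : Word n) → hasInv k w ≡ false →
  Maybe.map QR (replaceFirst (isVal (suc k)) b w) ≡ replaceFirstᵀ (isVal (suc k)) b (QR w)
QR-replaceFirst {n} k b b≡k = ∷ʳ-induction P (λ _ → refl) step
  where
  q : Fin n → Bool
  q = isVal (suc k)
  P : Word n → Set
  P w = hasInv k w ≡ false → Maybe.map QR (replaceFirst q b w) ≡ replaceFirstᵀ q b (QR w)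

  lower-atMost : (a : Fin n) → q a ≡ true → ∀ (c : Fin n × Bool) → EntryAtMost (toℕ a) c → entry c ≢ suc k → EntryAtMost (toℕ b) c
  lower-atMost a a≡k+1 c c≤a c≢k+1 =
    subst (entry c ≤_) (sym b≡k) (s≤s⁻¹ (≤∧≢⇒< (subst (entry c ≤_) (isVal⇒≡ {c = a} a≡k+1) c≤a) c≢k+1))

  lower-above : (a : Fin n) → q a ≡ true → ∀ (c : Fin n × Bool) → EntryAbove (toℕ a) c → EntryAbove (toℕ b) c
  lower-above a a≡k+1 _ = <-trans (subst₂ _<_ (sym b≡k) (sym (isVal⇒≡ {c = a} a≡k+1)) (n<1+n k))

  replaced-atMost : (a : Fin n) → ∀ x below → q x ≡ true → EntryAtMost (toℕ a) (x , below) → EntryAtMost (toℕ a) (b , below)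
  replaced-atMost a x _ x≡k+1 x≤a =
    subst (_≤ toℕ a) (sym b≡k) (≤-trans (n≤1+n k) (subst (_≤ toℕ a) (isVal⇒≡ {c = x} x≡k+1) x≤a))

  replaced-above : (a : Fin n) → isVal k a ≡ false → ∀ x below → q x ≡ true →
    EntryAbove (toℕ a) (x , below) → EntryAbove (toℕ a) (b , below)
  replaced-above a a≢k x _ x≡k+1 a<x =
    subst (toℕ a <_) (sym b≡k) (≤∧≢⇒< (s≤s⁻¹ (subst (toℕ a <_) (isVal⇒≡ {c = x} x≡k+1) a<x)) (isVal-false⇒≢ {c = a} a≢k))

  step : ∀ w a → P w → P (w ∷ʳ a)
  step w a ih no-inv with ∨-false⁻ {hasInv k w} (trans (sym (hasInv-∷ʳ k w a)) no-inv)
                        | sorted-split a (QR w) (QR-sorted w)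
  ... | no-inv-w , no-late-k | p , s , QRw≡ps , atMost , above
    rewrite replaceFirst-∷ʳ q b w a | QR-∷ʳ w a with replaceFirst q b w in w↦ | ih no-inv-w
  ... | just w' | QRw'≡ rewrite QR-∷ʳ w' a | QRw≡ps | insertQR-++ a p s atMost above
          | replaceFirstᵀ-++ q b p ((a , false) ∷ attachBelow s) = go (replaceFirstᵀ q b p) refl
    where
    a≢k : isVal k a ≡ false
    a≢k = trans (sym (∧-identityʳ _)) (subst (λ z → isVal k a ∧ z ≡ false) (replaceFirst-just⇒present q b w w' w↦) no-late-k)
    QRw'≡split : just (QR w') ≡ replaceFirstᵀ-++-result q b p s (replaceFirstᵀ q b p)
    QRw'≡split = trans QRw'≡ (replaceFirstᵀ-++ q b p s)
    go : ∀ r → replaceFirstᵀ q b p ≡ r → just (insertQR a (QR w')) ≡ replaceFirstᵀ-++-result q b p ((a , false) ∷ attachBelow s) r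
    go (just p') p↦p' rewrite just-injective (trans QRw'≡split (cong (replaceFirstᵀ-++-result q b p s) p↦p'))
      | insertQR-++ a p' s (replaceFirstᵀ-All q b p p' p↦p' atMost (replaced-atMost a)) above = refl
    go nothing p↦ with q a in a≡k+1
    ... | true = ⊥-elim (nothing≢just (sym (trans QRw'≡split (trans (cong (replaceFirstᵀ-++-result q b p s) p↦)
                   (cong (Maybe.map (p ++_)) (replaceFirstᵀ-absent q b s
                     (any-isVal-above s (suc k) above (≤-reflexive (sym (isVal⇒≡ a≡k+1))))))))))
    ... | false rewrite replaceFirstᵀ-attachBelow q b s with replaceFirstᵀ q b s in s↦
    ...   | nothing = ⊥-elim (nothing≢just (sym (trans QRw'≡split (trans (cong (replaceFirstᵀ-++-result q b p s) p↦)
                        (cong (Maybe.map (p ++_)) s↦)))))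
    ...   | just s' rewrite just-injective (trans QRw'≡split (trans (cong (replaceFirstᵀ-++-result q b p s) p↦)
                        (cong (Maybe.map (p ++_)) s↦)))
      | insertQR-++ a p s' atMost (replaceFirstᵀ-All q b s s' s↦ above (replaced-above a a≢k)) = refl
  ... | nothing | _ with QR-split-absent (suc k) w p s QRw≡ps (replaceFirst-nothing⇒absent q b w w↦)
  ...   | p-lacks-k+1 , s-lacks-k+1 rewrite QRw≡ps | insertQR-++ a p s atMost above
          | replaceFirstᵀ-++ q b p ((a , false) ∷ attachBelow s) | replaceFirstᵀ-absent q b p p-lacks-k+1 with q a in a≡k+1
  ...     | true rewrite QR-∷ʳ w b | QRw≡ps
            | insertQR-++ b p s (All-weaken-absent (suc k) p atMost p-lacks-k+1 (lower-atMost a a≡k+1)) (All.map (λ {c} → lower-above a a≡k+1 c) above)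
            = refl
  ...     | false rewrite replaceFirstᵀ-attachBelow q b s | replaceFirstᵀ-absent q b s s-lacks-k+1 = refl

QR-fOp : ∀ {n} k (h : suc k < n) (w : Word n) → Maybe.map QR (fOp k h w) ≡ fᵀ k h (QR w)
QR-fOp k h w with hasInv k w in inv | hasInv≡hasInvᵀ∘QR k w
... | true | inv≡ rewrite sym inv≡ = refl
... | false | inv≡ rewrite sym inv≡ = QR-replaceLast k (fromℕ< h) (toℕ-fromℕ< h) w inv

QR-eOp : ∀ {n} k (h : suc k < n) (w : Word n) → Maybe.map QR (eOp k h w) ≡ eᵀ k h (QR w)
QR-eOp k h w with hasInv k w in inv | hasInv≡hasInvᵀ∘QR k w
... | true | inv≡ rewrite sym inv≡ = refl
... | false | inv≡ rewrite sym inv≡ = QR-replaceFirst k (fromℕ< _) (toℕ-fromℕ< _) w inv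

module _ {n : ℕ} (k : ℕ) {B b : Fin n} (B≡k+1 : toℕ B ≡ suc k) (b≡k : toℕ b ≡ k) where

  replaceLast-inverse : (x y : Word n) → hasInv k x ≡ false → replaceLast (isVal k) B x ≡ just y →
    hasInv k y ≡ false × replaceFirst (isVal (suc k)) b y ≡ just x
  replaceLast-inverse (c ∷ u) y no-inv e with ∨-false⁻ {isVal (suc k) c ∧ any (isVal k) u} no-inv
  ... | no-inv-c , no-inv-u with replaceLast (isVal k) B u in u↦
  ...   | just u' with e
  ...     | refl with replaceLast-inverse u u' no-inv-u u↦
  ...       | no-inv-u' , u'↦
    rewrite ∧-false⇒false (replaceLast-just⇒present (isVal k) B u u' u↦) no-inv-c | u'↦
    = no-inv-u' , refl
  replaceLast-inverse (c ∷ u) y no-inv e | no-inv-c , no-inv-u | nothing with isVal k c in c≡k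
  replaceLast-inverse (c ∷ u) _ no-inv refl | no-inv-c , no-inv-u | nothing | true
    rewrite replaceLast-nothing⇒absent (isVal k) B u u↦ | no-inv-u | ≡⇒isVal {k = suc k} {c = B} B≡k+1
    = refl , cong (λ z → just (z ∷ u)) (toℕ-injective (trans b≡k (sym (isVal⇒≡ {c = c} c≡k))))

  replaceFirst-inverse : (y x : Word n) → hasInv k y ≡ false → replaceFirst (isVal (suc k)) b y ≡ just x →
    hasInv k x ≡ false × replaceLast (isVal k) B x ≡ just y
  replaceFirst-inverse (c ∷ u) x no-inv e with ∨-false⁻ {isVal (suc k) c ∧ any (isVal k) u} no-inv
  ... | no-inv-c , no-inv-u with isVal (suc k) c in c≡k+1
  replaceFirst-inverse (c ∷ u) _ no-inv refl | no-inv-c , no-inv-u | true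
    rewrite ≢⇒isVal-false {k = suc k} {c = b} (n≢1+n ∘ trans (sym b≡k))
          | replaceLast-absent (isVal k) B u no-inv-c | ≡⇒isVal {k = k} {c = b} b≡k
    = no-inv-u , cong (λ z → just (z ∷ u)) (toℕ-injective (trans B≡k+1 (sym (isVal⇒≡ {c = c} c≡k+1))))
  ... | false with replaceFirst (isVal (suc k)) b u in u↦
  replaceFirst-inverse (c ∷ u) _ no-inv refl | no-inv-c , no-inv-u | false | just u'
    with replaceFirst-inverse u u' no-inv-u u↦
  ... | no-inv-u' , u'↦ rewrite c≡k+1 | u'↦ = no-inv-u' , refl

fOp⇒eOp : ∀ {n} k (h : suc k < n) (x y : Word n) → fOp k h x ≡ just y → eOp k h y ≡ just x
fOp⇒eOp k h x y x↦y with hasInv k x in no-inv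
... | false with replaceLast-inverse k (toℕ-fromℕ< h) (toℕ-fromℕ< _) x y no-inv x↦y
...   | no-inv-y , y↦x rewrite no-inv-y = y↦x

eOp⇒fOp : ∀ {n} k (h : suc k < n) (y x : Word n) → eOp k h y ≡ just x → fOp k h x ≡ just y
eOp⇒fOp k h y x y↦x with hasInv k y in no-inv
... | false with replaceFirst-inverse k (toℕ-fromℕ< h) (toℕ-fromℕ< _) y x no-inv y↦x
...   | no-inv-x , x↦y rewrite no-inv-x = x↦y

module _ {n : ℕ} where

  inverts : Fin n → Fin n → Bool
  inverts a b = toℕ b <ᵇ toℕ a

  InvertsAlike : Fin n → Fin n → Word n → Word n → Set
  InvertsAlike a a' [] [] = ⊤
  InvertsAlike a a' (b ∷ y) (b' ∷ y') = inverts a b ≡ inverts a' b' × InvertsAlike a a' y y'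
  InvertsAlike a a' _ _ = ⊥

  -- Equal standardizations: the same pairs of positions form inversions.
  SameStd : Word n → Word n → Set
  SameStd [] [] = ⊤
  SameStd (a ∷ y) (a' ∷ y') = InvertsAlike a a' y y' × SameStd y y'
  SameStd _ _ = ⊥

  InvertsAlike? : ∀ a a' y y' → Dec (InvertsAlike a a' y y')
  InvertsAlike? a a' [] [] = yes tt
  InvertsAlike? a a' (b ∷ y) (b' ∷ y') = (inverts a b Bool.≟ inverts a' b') ×-dec InvertsAlike? a a' y y'
  InvertsAlike? a a' [] (_ ∷ _) = no λ ()
  InvertsAlike? a a' (_ ∷ _) [] = no λ ()

  SameStd? : ∀ y y' → Dec (SameStd y y')
  SameStd? [] [] = yes tt
  SameStd? (a ∷ y) (a' ∷ y') = InvertsAlike? a a' y y' ×-dec SameStd? y y'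
  SameStd? [] (_ ∷ _) = no λ ()
  SameStd? (_ ∷ _) [] = no λ ()

  InvertsAlike-refl : ∀ a y → InvertsAlike a a y y
  InvertsAlike-refl a [] = tt
  InvertsAlike-refl a (b ∷ y) = refl , InvertsAlike-refl a y

  SameStd-refl : ∀ y → SameStd y y
  SameStd-refl [] = tt
  SameStd-refl (a ∷ y) = InvertsAlike-refl a y , SameStd-refl y

  InvertsAlike-sym : ∀ {a a'} y y' → InvertsAlike a a' y y' → InvertsAlike a' a y' y
  InvertsAlike-sym [] [] _ = tt
  InvertsAlike-sym (_ ∷ y) (_ ∷ y') (e , alike) = sym e , InvertsAlike-sym y y' alike

  SameStd-sym : ∀ y y' → SameStd y y' → SameStd y' y
  SameStd-sym [] [] _ = tt
  SameStd-sym (_ ∷ y) (_ ∷ y') (alike , same) = InvertsAlike-sym y y' alike , SameStd-sym y y' same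

  InvertsAlike-trans : ∀ {a a' a''} y y' y'' → InvertsAlike a a' y y' → InvertsAlike a' a'' y' y'' → InvertsAlike a a'' y y''
  InvertsAlike-trans [] [] [] _ _ = tt
  InvertsAlike-trans (_ ∷ y) (_ ∷ y') (_ ∷ y'') (e , alike) (e' , alike') = trans e e' , InvertsAlike-trans y y' y'' alike alike'

  SameStd-trans : ∀ y y' y'' → SameStd y y' → SameStd y' y'' → SameStd y y''
  SameStd-trans [] [] [] _ _ = tt
  SameStd-trans (_ ∷ y) (_ ∷ y') (_ ∷ y'') (alike , same) (alike' , same') =
    InvertsAlike-trans y y' y'' alike alike' , SameStd-trans y y' y'' same same'

  SameStd⇒length : ∀ y y' → SameStd y y' → length y ≡ length y'
  SameStd⇒length [] [] _ = refl
  SameStd⇒length (_ ∷ y) (_ ∷ y') (_ , same) = cong suc (SameStd⇒length y y' same)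

module _ {n : ℕ} (k : ℕ) {B : Fin n} (B≡k+1 : toℕ B ≡ suc k) where

  inverts-raiseʳ : (b c : Fin n) → toℕ b ≡ k → toℕ c ≢ suc k → inverts c b ≡ inverts c B
  inverts-raiseʳ b c b≡k c≢k+1 with toℕ b <ᵇ toℕ c in b<c
  ... | true = sym (<⇒<ᵇ-true (subst (_< toℕ c) (sym B≡k+1)
                 (≤∧≢⇒< (subst (_< toℕ c) b≡k (<ᵇ-true⇒< _ _ b<c)) (c≢k+1 ∘ sym))))
  ... | false = sym (≮⇒<ᵇ-false λ B<c → <ᵇ-false⇒≮ b<c (subst (_< toℕ c) (sym b≡k)
                 (<-trans (n<1+n k) (subst (_< toℕ c) B≡k+1 B<c))))

  inverts-raiseˡ : (b d : Fin n) → toℕ b ≡ k → toℕ d ≢ k → inverts b d ≡ inverts B d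
  inverts-raiseˡ b d b≡k d≢k with toℕ d <ᵇ toℕ b in d<b
  ... | true = sym (<⇒<ᵇ-true (subst (toℕ d <_) (sym B≡k+1)
                 (<-trans (subst (toℕ d <_) b≡k (<ᵇ-true⇒< _ _ d<b)) (n<1+n k))))
  ... | false = sym (≮⇒<ᵇ-false λ d<B → <ᵇ-false⇒≮ d<b (subst (toℕ d <_) (sym b≡k)
                 (≤∧≢⇒< (s≤s⁻¹ (subst (toℕ d <_) B≡k+1 d<B)) d≢k)))

  InvertsAlike-raise : (b : Fin n) (u : Word n) → any (isVal k) u ≡ false → toℕ b ≡ k → InvertsAlike b B u u
  InvertsAlike-raise b [] _ _ = tt
  InvertsAlike-raise b (d ∷ u) none b≡k =
    inverts-raiseˡ b d b≡k (isVal-false⇒≢ (proj₁ (∨-false⁻ none))) , InvertsAlike-raise b u (proj₂ (∨-false⁻ none)) b≡k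

  replaceLast-InvertsAlike : (c : Fin n) (u u' : Word n) → isVal (suc k) c ≡ false →
    replaceLast (isVal k) B u ≡ just u' → InvertsAlike c c u u'
  replaceLast-InvertsAlike c (d ∷ t) u' c≢k+1 e with replaceLast (isVal k) B t in t↦
  replaceLast-InvertsAlike c (d ∷ t) _ c≢k+1 refl | just t' = refl , replaceLast-InvertsAlike c t t' c≢k+1 t↦
  ... | nothing with isVal k d in d≡k
  replaceLast-InvertsAlike c (d ∷ t) _ c≢k+1 refl | nothing | true =
    inverts-raiseʳ d c (isVal⇒≡ {c = d} d≡k) (isVal-false⇒≢ c≢k+1) , InvertsAlike-refl c t

replaceLast-SameStd : ∀ {n} k (B : Fin n) → toℕ B ≡ suc k → (x y : Word n) → hasInv k x ≡ false →
  replaceLast (isVal k) B x ≡ just y → SameStd x y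
replaceLast-SameStd k B B≡k+1 (c ∷ u) y no-inv e with ∨-false⁻ {isVal (suc k) c ∧ any (isVal k) u} no-inv
... | no-inv-c , no-inv-u with replaceLast (isVal k) B u in u↦
replaceLast-SameStd k B B≡k+1 (c ∷ u) _ no-inv refl | no-inv-c , no-inv-u | just u' =
  replaceLast-InvertsAlike k B≡k+1 c u u' (∧-false⇒false (replaceLast-just⇒present (isVal k) B u u' u↦) no-inv-c) u↦ ,
  replaceLast-SameStd k B B≡k+1 u u' no-inv-u u↦
... | nothing with isVal k c in c≡k
replaceLast-SameStd k B B≡k+1 (c ∷ u) _ no-inv refl | no-inv-c , no-inv-u | nothing | true =
  InvertsAlike-raise k B≡k+1 c u (replaceLast-nothing⇒absent (isVal k) B u u↦) (isVal⇒≡ {c = c} c≡k) , SameStd-refl u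

fOp-SameStd : ∀ {n} k (h : suc k < n) (x y : Word n) → fOp k h x ≡ just y → SameStd x y
fOp-SameStd k h x y x↦y with hasInv k x in no-inv
... | false = replaceLast-SameStd k (fromℕ< h) (toℕ-fromℕ< h) x y no-inv x↦y

Conn⇒SameStd : ∀ {n} (u x : Word n) → Conn u x → SameStd u x
Conn⇒SameStd u .u ε = SameStd-refl u
Conn⇒SameStd u x (fwd (k , h , u↦) ◅ path) = SameStd-trans _ _ _ (fOp-SameStd k h u _ u↦) (Conn⇒SameStd _ x path)
Conn⇒SameStd u x (bwd (k , h , ↦u) ◅ path) =
  SameStd-trans _ _ _ (SameStd-sym _ _ (fOp-SameStd k h _ u ↦u)) (Conn⇒SameStd _ x path)

module _ {n : ℕ} where

  countℕ : ℕ → Word n → ℕ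
  countℕ j [] = 0
  countℕ j (b ∷ w) = if toℕ b ≡ᵇ j then suc (countℕ j w) else countℕ j w

  countBelow : ℕ → Word n → ℕ
  countBelow m [] = 0
  countBelow m (b ∷ w) = if toℕ b <ᵇ m then suc (countBelow m w) else countBelow m w

  count≡countℕ : (c : Fin n) (w : Word n) → count c w ≡ countℕ (toℕ c) w
  count≡countℕ c [] = refl
  count≡countℕ c (b ∷ w) rewrite count≡countℕ c w = refl

  countℕ-out-of-range : ∀ j (w : Word n) → n ≤ j → countℕ j w ≡ 0
  countℕ-out-of-range j [] _ = refl
  countℕ-out-of-range j (b ∷ w) n≤j
    rewrite ≢⇒≡ᵇ-false (toℕ b) j (λ b≡j → <-irrefl refl (<-≤-trans (subst (_< n) b≡j (toℕ<n b)) n≤j))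
    = countℕ-out-of-range j w n≤j

  count≡⇒countℕ≡ : (y y' : Word n) → (∀ c → count c y ≡ count c y') → ∀ j → countℕ j y ≡ countℕ j y'
  count≡⇒countℕ≡ y y' same j with j <? n
  ... | yes j<n = subst (λ i → countℕ i y ≡ countℕ i y') (toℕ-fromℕ< j<n)
                    (trans (sym (count≡countℕ (fromℕ< j<n) y)) (trans (same _) (count≡countℕ (fromℕ< j<n) y')))
  ... | no j≮n = trans (countℕ-out-of-range j y (≮⇒≥ j≮n)) (sym (countℕ-out-of-range j y' (≮⇒≥ j≮n)))

  countBelow-suc : ∀ m (w : Word n) → countBelow (suc m) w ≡ countBelow m w + countℕ m w
  countBelow-suc m [] = refl
  countBelow-suc m (b ∷ w) with <-cmp (toℕ b) m
  ... | tri< b<m b≢m _ rewrite <⇒<ᵇ-true (<-trans b<m (n<1+n m)) | <⇒<ᵇ-true b<m | ≢⇒≡ᵇ-false _ _ b≢m =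
    cong suc (countBelow-suc m w)
  ... | tri≈ _ b≡m _ rewrite <⇒<ᵇ-true (subst (_< suc m) (sym b≡m) (n<1+n m)) | ≮⇒<ᵇ-false (<-irrefl b≡m)
                           | ≡⇒≡ᵇ-true _ _ b≡m =
    trans (cong suc (countBelow-suc m w)) (sym (+-suc _ _))
  ... | tri> _ b≢m m<b rewrite ≮⇒<ᵇ-false (<⇒≱ m<b ∘ s≤s⁻¹) | ≮⇒<ᵇ-false (<-asym m<b) | ≢⇒≡ᵇ-false _ _ b≢m =
    countBelow-suc m w

  countBelow-mono : ∀ {m m'} (w : Word n) → m ≤ m' → countBelow m w ≤ countBelow m' w
  countBelow-mono [] _ = z≤n
  countBelow-mono {m} {m'} (b ∷ w) m≤m' with toℕ b <ᵇ m in b<m | toℕ b <ᵇ m' in b<m'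
  ... | true | true = s≤s (countBelow-mono w m≤m')
  ... | true | false = ⊥-elim (<ᵇ-false⇒≮ b<m' (<-≤-trans (<ᵇ-true⇒< _ _ b<m) m≤m'))
  ... | false | true = m≤n⇒m≤1+n (countBelow-mono w m≤m')
  ... | false | false = countBelow-mono w m≤m'

  countℕ-head : (a : Fin n) (w : Word n) → countℕ (toℕ a) (a ∷ w) ≡ suc (countℕ (toℕ a) w)
  countℕ-head a w rewrite ≡⇒≡ᵇ-true (toℕ a) (toℕ a) refl = refl

  countBelow-zero : (w : Word n) → countBelow 0 w ≡ 0
  countBelow-zero [] = refl
  countBelow-zero (_ ∷ w) = countBelow-zero w

  countℕ≡⇒countBelow≡ : (y y' : Word n) → (∀ j → countℕ j y ≡ countℕ j y') → ∀ m → countBelow m y ≡ countBelow m y'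
  countℕ≡⇒countBelow≡ y y' same zero = trans (countBelow-zero y) (sym (countBelow-zero y'))
  countℕ≡⇒countBelow≡ y y' same (suc m)
    rewrite countBelow-suc m y | countBelow-suc m y' | countℕ≡⇒countBelow≡ y y' same m | same m = refl

  InvertsAlike⇒countBelow≡ : ∀ a a' y y' → InvertsAlike a a' y y' → countBelow (toℕ a) y ≡ countBelow (toℕ a') y'
  InvertsAlike⇒countBelow≡ a a' [] [] _ = refl
  InvertsAlike⇒countBelow≡ a a' (b ∷ y) (b' ∷ y') (e , alike) with toℕ b <ᵇ toℕ a | toℕ b' <ᵇ toℕ a'
  InvertsAlike⇒countBelow≡ a a' (b ∷ y) (b' ∷ y') (refl , alike) | true | true =
    cong suc (InvertsAlike⇒countBelow≡ a a' y y' alike)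
  InvertsAlike⇒countBelow≡ a a' (b ∷ y) (b' ∷ y') (refl , alike) | false | false =
    InvertsAlike⇒countBelow≡ a a' y y' alike

  -- The standardization fixes how many later letters lie below the first one; together with the
  -- content this forces the first letters to agree.
  InvertsAlike⇒≮ : ∀ a a' y y' → InvertsAlike a a' y y' → (∀ j → countℕ j (a ∷ y) ≡ countℕ j (a' ∷ y')) →
    ¬ toℕ a < toℕ a'
  InvertsAlike⇒≮ a a' y y' alike same a<a' = <-irrefl (sym below-a'≡below-a) below-a<below-a'
    where
    skip-self : ∀ (x : Fin n) w → countBelow (toℕ x) (x ∷ w) ≡ countBelow (toℕ x) w
    skip-self x w rewrite ≮⇒<ᵇ-false (<-irrefl {toℕ x} refl) = refl
    below-a'≡below-a : countBelow (toℕ a') (a' ∷ y') ≡ countBelow (toℕ a) (a' ∷ y')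
    below-a'≡below-a = trans (skip-self a' y') (trans (sym (InvertsAlike⇒countBelow≡ a a' y y' alike))
                         (trans (sym (skip-self a y)) (countℕ≡⇒countBelow≡ (a ∷ y) (a' ∷ y') same (toℕ a))))
    a-occurs : 1 ≤ countℕ (toℕ a) (a' ∷ y')
    a-occurs = subst (1 ≤_) (same (toℕ a)) (subst (1 ≤_) (sym (countℕ-head a y)) (s≤s z≤n))
    below-a<below-a' : countBelow (toℕ a) (a' ∷ y') < countBelow (toℕ a') (a' ∷ y')
    below-a<below-a' = begin
      suc (countBelow (toℕ a) (a' ∷ y'))                      ≡⟨ +-comm 1 _ ⟩
      countBelow (toℕ a) (a' ∷ y') + 1                        ≤⟨ +-monoʳ-≤ (countBelow (toℕ a) (a' ∷ y')) a-occurs ⟩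
      countBelow (toℕ a) (a' ∷ y') + countℕ (toℕ a) (a' ∷ y') ≡⟨ sym (countBelow-suc (toℕ a) (a' ∷ y')) ⟩
      countBelow (suc (toℕ a)) (a' ∷ y')                      ≤⟨ countBelow-mono (a' ∷ y') a<a' ⟩
      countBelow (toℕ a') (a' ∷ y')                           ∎
      where open ≤-Reasoning

  SameStd⇒≡ : ∀ y y' → SameStd y y' → (∀ j → countℕ j y ≡ countℕ j y') → y ≡ y'
  SameStd⇒≡ [] [] _ _ = refl
  SameStd⇒≡ (a ∷ y) (a' ∷ y') (alike , same) counts with <-cmp (toℕ a) (toℕ a')
  ... | tri< a<a' _ _ = ⊥-elim (InvertsAlike⇒≮ a a' y y' alike counts a<a')
  ... | tri> _ _ a'<a = ⊥-elim (InvertsAlike⇒≮ a' a y' y (InvertsAlike-sym y y' alike) (sym ∘ counts) a'<a)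
  ... | tri≈ _ a≡a' _ with toℕ-injective a≡a'
  ...   | refl = cong (a ∷_) (SameStd⇒≡ y y' same tail-counts)
    where
    tail-counts : ∀ j → countℕ j y ≡ countℕ j y'
    tail-counts j with counts j
    ... | counts-j with toℕ a ≡ᵇ j
    ...   | true = suc-injective counts-j
    ...   | false = counts-j

module _ {n : ℕ} where

  count≡⇒wt≡ : (y y' : Word n) → (∀ c → count c y ≡ count c y') → wt y ≡ wt y'
  count≡⇒wt≡ y y' = tabulate-cong

  wt≡⇒count≡ : (y y' : Word n) → wt y ≡ wt y' → ∀ c → count c y ≡ count c y'
  wt≡⇒count≡ y y' same c =
    trans (sym (lookup∘tabulate (λ a → count a y) c)) (trans (cong (λ V → lookup V c) same) (lookup∘tabulate (λ a → count a y') c))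

  QR≡⇒count≡ : (y y' : Word n) → QR y ≡ QR y' → ∀ c → count c y ≡ count c y'
  QR≡⇒count≡ y y' same c = trans (sym (count-QR c y)) (trans (cong (count c ∘ content) same) (count-QR c y'))

  SameStd-QR⇒≡ : (y y' : Word n) → SameStd y y' → QR y ≡ QR y' → y ≡ y'
  SameStd-QR⇒≡ y y' same-std same-QR = SameStd⇒≡ y y' same-std (count≡⇒countℕ≡ y y' (QR≡⇒count≡ y y' same-QR))

  QR-injective-on-component : (w y₁ y₂ : Word n) → Conn w y₁ → Conn w y₂ → QR y₁ ≡ QR y₂ → y₁ ≡ y₂
  QR-injective-on-component w y₁ y₂ c₁ c₂ =
    SameStd-QR⇒≡ y₁ y₂ (SameStd-trans _ _ _ (SameStd-sym _ _ (Conn⇒SameStd w y₁ c₁)) (Conn⇒SameStd w y₂ c₂))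

  QR-transport-step : (x x' y : Word n) → QR x ≡ QR y → SymClosure Adj x x' → ∃[ y' ] (SymClosure Adj y y' × QR y' ≡ QR x')
  QR-transport-step x x' y same (fwd (k , h , x↦x')) with map≡just⁻ QR (fOp k h y)
    (trans (QR-fOp k h y) (trans (cong (fᵀ k h) (sym same)) (trans (sym (QR-fOp k h x)) (cong (Maybe.map QR) x↦x'))))
  ... | y' , y↦y' , same' = y' , fwd (k , h , y↦y') , same'
  QR-transport-step x x' y same (bwd (k , h , x'↦x)) with map≡just⁻ QR (eOp k h y)
    (trans (QR-eOp k h y) (trans (cong (eᵀ k h) (sym same)) (trans (sym (QR-eOp k h x)) (cong (Maybe.map QR) (fOp⇒eOp k h x' x x'↦x)))))
  ... | y' , y↦y' , same' = y' , bwd (k , h , eOp⇒fOp k h y y' y↦y') , same'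

  QR-transport : (x x' y : Word n) → QR x ≡ QR y → Conn x x' → ∃[ y' ] (Conn y y' × QR y' ≡ QR x')
  QR-transport x .x y same ε = y , ε , sym same
  QR-transport x x' y same (step ◅ path) with QR-transport-step x _ y same step
  ... | y₁ , step' , same₁ with QR-transport _ x' y₁ (sym same₁) path
  ...   | y' , path' , same' = y' , step' ◅ path' , same'

module _ {n : ℕ} where

  countℕ-absent : (j : ℕ) (S : QRTab n) → All (EntryNot j) S → countℕ j (content S) ≡ 0
  countℕ-absent j [] [] = refl
  countℕ-absent j ((x , _) ∷ S) (x≢j ∷ avoids) rewrite ≢⇒≡ᵇ-false (toℕ x) j x≢j = countℕ-absent j S avoids

  any-present : (q : Fin n → Bool) (P r : QRTab n) (c : Fin n × Bool) → q (proj₁ c) ≡ true →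
    any q (content (P ++ c ∷ r)) ≡ true
  any-present q P r c qc rewrite content-++ P (c ∷ r) | any-++ q (content P) (proj₁ c ∷ content r) | qc = ∨-zeroʳ _

  countℕ-smaller-absent : ∀ {a a' : Fin n} {t : QRTab n} → toℕ a < toℕ a' → All (EntryAtLeast (toℕ a')) t →
    countℕ (toℕ a) (a' ∷ content t) ≡ 0
  countℕ-smaller-absent {a} {a'} {t} a<a' a'≤t = countℕ-absent (toℕ a) ((a' , false) ∷ t)
    ((λ a'≡a → <-irrefl (sym a'≡a) a<a') ∷ atLeast⇒EntryNot a<a' a'≤t)

  Sorted-content-≡ : (T T' : QRTab n) → Sorted T → Sorted T' →
    (∀ j → countℕ j (content T) ≡ countℕ j (content T')) → content T ≡ content T'
  Sorted-content-≡ [] [] _ _ _ = refl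
  Sorted-content-≡ [] ((a , _) ∷ t) _ _ same = ⊥-elim (0≢1+n (trans (same (toℕ a)) (countℕ-head a (content t))))
  Sorted-content-≡ ((a , _) ∷ t) [] _ _ same = ⊥-elim (0≢1+n (trans (sym (same (toℕ a))) (countℕ-head a (content t))))
  Sorted-content-≡ ((a , f) ∷ t) ((a' , f') ∷ t') (a≤t ∷ sorted) (a'≤t' ∷ sorted') same with <-cmp (toℕ a) (toℕ a')
  ... | tri< a<a' _ _ = ⊥-elim (0≢1+n (sym (trans (sym (countℕ-head a (content t)))
                          (trans (same (toℕ a)) (countℕ-smaller-absent a<a' a'≤t')))))
  ... | tri> _ _ a'<a = ⊥-elim (0≢1+n (sym (trans (sym (countℕ-head a' (content t')))
                          (trans (sym (same (toℕ a'))) (countℕ-smaller-absent a'<a a≤t)))))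
  ... | tri≈ _ a≡a' _ with toℕ-injective a≡a'
  ...   | refl = cong (a ∷_) (Sorted-content-≡ t t' sorted sorted' tail-counts)
    where
    tail-counts : ∀ j → countℕ j (content t) ≡ countℕ j (content t')
    tail-counts j with same j
    ... | same-j with toℕ a ≡ᵇ j
    ...   | true = suc-injective same-j
    ...   | false = same-j

  fᵀ-raise : (P₀ S : QRTab n) (e x : Fin n) (f d : Bool) (k : ℕ) (h : suc k < n) →
    toℕ e ≡ k → suc k < toℕ x → All (EntryAtMost k) P₀ → All (EntryAtLeast (toℕ x)) S →
    fᵀ k h (P₀ ++ (e , f) ∷ (x , d) ∷ S) ≡ just (P₀ ++ (fromℕ< h , f) ∷ (x , d) ∷ S)
  fᵀ-raise P₀ S e x f d k h e≡k k+1<x atMost atLeast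
    rewrite firstFlag-absent (isVal (suc k)) (P₀ ++ (e , f) ∷ (x , d) ∷ S)
              (absent⇒any-isVal-false (suc k) _ (All-++⁺ (atMost⇒EntryNot (n<1+n k) atMost)
                ((n≢1+n ∘ trans (sym e≡k)) ∷ (λ x≡k+1 → <-irrefl (sym x≡k+1) k+1<x) ∷ atLeast⇒EntryNot k+1<x atLeast)))
          | ∧-zeroʳ (any (isVal k) (content (P₀ ++ (e , f) ∷ (x , d) ∷ S)))
          | replaceLastᵀ-++ (isVal k) (fromℕ< h) P₀ ((e , f) ∷ (x , d) ∷ S)
          | replaceLastᵀ-absent (isVal k) (fromℕ< h) ((x , d) ∷ S)
              (absent⇒any-isVal-false k ((x , d) ∷ S)
                ((λ x≡k → <-irrefl (sym x≡k) (<-trans (n<1+n k) k+1<x)) ∷ atLeast⇒EntryNot (<-trans (n<1+n k) k+1<x) atLeast))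
          | ≡⇒isVal {k = k} {c = e} e≡k
          = refl

  fᵀ-blocked-by-flag : (P₀ S : QRTab n) (e x : Fin n) (f d : Bool) (k : ℕ) (h : suc k < n) →
    toℕ e ≡ k → toℕ x ≡ suc k → All (EntryAtMost k) P₀ → All (EntryAtLeast (toℕ x)) S →
    fᵀ k h (P₀ ++ (e , f) ∷ (x , d) ∷ S) ≡ (if d then nothing else just (P₀ ++ (fromℕ< h , f) ∷ (x , d) ∷ S))
  fᵀ-blocked-by-flag P₀ S e x f d k h e≡k x≡k+1 atMost atLeast
    rewrite any-present (isVal k) P₀ ((x , d) ∷ S) (e , f) (≡⇒isVal {k = k} {c = e} e≡k)
          | firstFlag-++ (isVal (suc k)) P₀ ((e , f) ∷ (x , d) ∷ S)
          | absent⇒any-isVal-false (suc k) P₀ (atMost⇒EntryNot (n<1+n k) atMost)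
          | ≢⇒isVal-false {k = suc k} {c = e} (n≢1+n ∘ trans (sym e≡k))
          | ≡⇒isVal {k = suc k} {c = x} x≡k+1
          with d
  ... | true = refl
  ... | false
    rewrite replaceLastᵀ-++ (isVal k) (fromℕ< h) P₀ ((e , f) ∷ (x , false) ∷ S)
          | replaceLastᵀ-absent (isVal k) (fromℕ< h) ((x , false) ∷ S)
              (absent⇒any-isVal-false k ((x , false) ∷ S)
                ((λ x≡k → n≢1+n (trans (sym x≡k) x≡k+1)) ∷ atLeast⇒EntryNot (subst (k <_) (sym x≡k+1) (n<1+n k)) atLeast))
          | ≡⇒isVal {k = k} {c = e} e≡k
          = refl

  ColumnStrict-equal-neighbours : ∀ m (P₀ : QRTab n) a f x d rest → ColumnStrict m (P₀ ++ (a , f) ∷ (x , d) ∷ rest) →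
    toℕ a ≡ toℕ x → d ≡ false
  ColumnStrict-equal-neighbours m [] a f x d rest (_ , ok , _) = ok
  ColumnStrict-equal-neighbours m ((y , _) ∷ P₀) a f x d rest (_ , cs) = ColumnStrict-equal-neighbours (just y) P₀ a f x d rest cs

  Sorted-prefix-atMost : ∀ (P : QRTab n) c r → Sorted (P ++ c ∷ r) → All (EntryAtMost (entry c)) P
  Sorted-prefix-atMost [] c r _ = []
  Sorted-prefix-atMost (d ∷ P) c r (d≤ ∷ sorted) = All.head (++⁻ʳ P d≤) ∷ Sorted-prefix-atMost P c r sorted

-- Two quasi-ribbon tableaux with the same content which admit the same fᵀ-moves are equal: whether
-- a cell x lies below its smaller predecessor e is detected by raising e step by step to x - 1 with
-- fᵀ and testing whether the last operator f_{x-1} is blocked.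
module Rigidity {n : ℕ} (R : QRTab n → QRTab n → Set)
  (forth : ∀ {T T'} k (h : suc k < n) T₁ → R T T' → fᵀ k h T ≡ just T₁ → ∃[ T₁' ] (fᵀ k h T' ≡ just T₁' × R T₁ T₁'))
  (back : ∀ {T T'} k (h : suc k < n) T₁' → R T T' → fᵀ k h T' ≡ just T₁' → ∃[ T₁ ] (fᵀ k h T ≡ just T₁))
  (tableaux : ∀ {T T'} → R T T' → IsQRTableau T × IsQRTableau T' × content T ≡ content T') where

  flags-agree : ∀ m (P₀ S S' : QRTab n) (e x : Fin n) f d d' → suc (toℕ e + m) ≡ toℕ x →
    All (EntryAtMost (toℕ e)) P₀ → All (EntryAtLeast (toℕ x)) S → All (EntryAtLeast (toℕ x)) S' →
    R (P₀ ++ (e , f) ∷ (x , d) ∷ S) (P₀ ++ (e , f) ∷ (x , d') ∷ S') → d ≡ d'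
  flags-agree zero P₀ S S' e x f d d' gap atMost atLeast atLeast' = compare d d'
    where
    x≡e+1 : toℕ x ≡ suc (toℕ e)
    x≡e+1 = trans (sym gap) (cong suc (+-identityʳ _))
    h : suc (toℕ e) < n
    h = subst (_< n) x≡e+1 (toℕ<n x)
    blocked-by-flag : ∀ {S} b → All (EntryAtLeast (toℕ x)) S →
      fᵀ (toℕ e) h (P₀ ++ (e , f) ∷ (x , b) ∷ S) ≡ (if b then nothing else just (P₀ ++ (fromℕ< h , f) ∷ (x , b) ∷ S))
    blocked-by-flag b = fᵀ-blocked-by-flag P₀ _ e x f b (toℕ e) h refl x≡e+1 atMost
    compare : ∀ d d' → R (P₀ ++ (e , f) ∷ (x , d) ∷ S) (P₀ ++ (e , f) ∷ (x , d') ∷ S') → d ≡ d'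
    compare true true _ = refl
    compare false false _ = refl
    compare false true r with forth (toℕ e) h _ r (blocked-by-flag false atLeast)
    ... | _ , moved , _ = ⊥-elim (nothing≢just (trans (sym (blocked-by-flag true atLeast')) moved))
    compare true false r with back (toℕ e) h _ r (blocked-by-flag false atLeast')
    ... | _ , moved = ⊥-elim (nothing≢just (trans (sym (blocked-by-flag true atLeast)) moved))
  flags-agree (suc m) P₀ S S' e x f d d' gap atMost atLeast atLeast' r = raise (<-trans e+1<x (toℕ<n x))
    where
    e+1<x : suc (toℕ e) < toℕ x
    e+1<x = subst (suc (toℕ e) <_) gap (s≤s (subst (suc (toℕ e) ≤_) (sym (+-suc (toℕ e) m)) (s≤s (m≤m+n (toℕ e) m))))
    raise : (h : suc (toℕ e) < n) → d ≡ d'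
    raise h with forth (toℕ e) h _ r (fᵀ-raise P₀ S e x f d (toℕ e) h refl e+1<x atMost atLeast)
    ... | _ , moved , r₁ with trans (sym moved) (fᵀ-raise P₀ S' e x f d' (toℕ e) h refl e+1<x atMost atLeast')
    ...   | refl = flags-agree m P₀ S S' (fromℕ< h) x f d d'
                     (trans (cong (λ z → suc (z + m)) (toℕ-fromℕ< h)) (trans (cong suc (sym (+-suc (toℕ e) m))) gap))
                     (All.map (λ c≤e → subst (_ ≤_) (sym (toℕ-fromℕ< h)) (m≤n⇒m≤1+n c≤e)) atMost) atLeast atLeast' r₁

  flag-after-cell : ∀ (P₀ R₂ R₂' : QRTab n) a f x d d' →
    R (P₀ ++ (a , f) ∷ (x , d) ∷ R₂) (P₀ ++ (a , f) ∷ (x , d') ∷ R₂') → d ≡ d'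
  flag-after-cell P₀ R₂ R₂' a f x d d' r with tableaux r
  ... | (sorted , cs) , (sorted' , cs') , _ with toℕ a ≟ toℕ x
  ...   | yes a≡x = trans (ColumnStrict-equal-neighbours nothing P₀ a f x d R₂ cs a≡x)
                      (sym (ColumnStrict-equal-neighbours nothing P₀ a f x d' R₂' cs' a≡x))
  ...   | no a≢x with Sorted-++⁻ʳ P₀ sorted | Sorted-++⁻ʳ P₀ sorted'
  ...     | (a≤x ∷ _) ∷ (x≤R₂ ∷ _) | _ ∷ (x≤R₂' ∷ _) with m≤n⇒∃[o]m+o≡n (≤∧≢⇒< a≤x a≢x)
  ...       | m , gap = flags-agree m P₀ R₂ R₂' a x f d d' gap (Sorted-prefix-atMost P₀ (a , f) _ sorted) x≤R₂ x≤R₂' r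

  first-flag-agree : ∀ (P R₂ R₂' : QRTab n) x d d' → R (P ++ (x , d) ∷ R₂) (P ++ (x , d') ∷ R₂') → d ≡ d'
  first-flag-agree P R₂ R₂' x d d' r with reverseView P
  ... | [] with tableaux r
  ...   | (_ , cs) , (_ , cs') , _ = trans (proj₁ cs) (sym (proj₁ cs'))
  first-flag-agree _ R₂ R₂' x d d' r | P₀ ∶ _ ∶ʳ (a , f) =
    flag-after-cell P₀ R₂ R₂' a f x d d' (subst₂ R (++-assoc P₀ _ _) (++-assoc P₀ _ _) r)

  agree-after : ∀ (P R₁ R₁' : QRTab n) → R (P ++ R₁) (P ++ R₁') → R₁ ≡ R₁'
  agree-after P R₁ R₁' r =
    go R₁ R₁' r (++-cancelˡ (content P) _ _ (trans (sym (content-++ P R₁)) (trans (proj₂ (proj₂ (tableaux r))) (content-++ P R₁'))))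
    where
    go : ∀ R₁ R₁' → R (P ++ R₁) (P ++ R₁') → content R₁ ≡ content R₁' → R₁ ≡ R₁'
    go [] [] _ _ = refl
    go ((x , d) ∷ R₂) ((x' , d') ∷ R₂') r same-content with ∷-injective same-content
    ... | refl , _ with first-flag-agree P R₂ R₂' x d d' r
    ...   | refl = cong ((x , d) ∷_) (agree-after (P ∷ʳ (x , d)) R₂ R₂'
                     (subst₂ R (sym (++-assoc P _ R₂)) (sym (++-assoc P _ R₂')) r))

  related⇒≡ : ∀ {T T'} → R T T' → T ≡ T'
  related⇒≡ = agree-after [] _ _

module _ {n : ℕ} where

  ∃-ofLength? : ∀ m {P : Word n → Set} → Decidable P → Dec (∃[ y ] (length y ≡ m × P y))
  ∃-ofLength? zero P? with P? []
  ... | yes p = yes ([] , refl , p)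
  ... | no ¬p = no λ { ([] , _ , p) → ¬p p ; (_ ∷ _ , () , _) }
  ∃-ofLength? (suc m) P? with Fin.any? (λ a → ∃-ofLength? m (λ y → P? (a ∷ y)))
  ... | yes (a , y , |y|≡m , p) = yes (a ∷ y , cong suc |y|≡m , p)
  ... | no none = no λ { ([] , () , _) ; (a ∷ y , |ay|≡1+m , p) → none (a , y , suc-injective |ay|≡1+m , p) }

  _≟ᵀ_ : DecidableEquality (QRTab n)
  _≟ᵀ_ = List.≡-dec (Product.≡-dec Fin._≟_ Bool._≟_)

  -- The component of v lies among the words of length |v|, so a finite search finds the word of
  -- that component with a prescribed tableau; v itself is only a default value.
  transfer : Word n → Word n → Word n
  transfer v x with ∃-ofLength? (length v) (λ y → SameStd? v y ×-dec (QR y ≟ᵀ QR x))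
  ... | yes (y , _) = y
  ... | no _ = v

  transfer-unique : (v x y : Word n) → Conn v y → QR y ≡ QR x → transfer v x ≡ y
  transfer-unique v x y v~y same with ∃-ofLength? (length v) (λ y → SameStd? v y ×-dec (QR y ≟ᵀ QR x))
  ... | yes (z , _ , v≈z , QRz≡QRx) =
    SameStd-QR⇒≡ z y (SameStd-trans _ _ _ (SameStd-sym _ _ v≈z) (Conn⇒SameStd v y v~y)) (trans QRz≡QRx (sym same))
  ... | no none = ⊥-elim (none (y , sym (SameStd⇒length v y (Conn⇒SameStd v y v~y)) , Conn⇒SameStd v y v~y , same))

  hypo⇒∼ : (u v : Word n) → u ≡hypo v → u ∼ v
  hypo⇒∼ u v QRu≡QRv = θ , (into , injective , surjective , weight , edges) , transfer-unique v u v ε (sym QRu≡QRv)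
    where
    θ : Word n → Word n
    θ = transfer v
    image : ∀ x → Conn u x → Conn v (θ x) × QR (θ x) ≡ QR x
    image x u~x with QR-transport u x v QRu≡QRv u~x
    ... | y , v~y , same rewrite transfer-unique v x y v~y same = v~y , same
    into : ∀ x → Conn u x → Conn v (θ x)
    into x u~x = proj₁ (image x u~x)
    same-QR : ∀ x → Conn u x → QR (θ x) ≡ QR x
    same-QR x u~x = proj₂ (image x u~x)
    injective : ∀ x y → Conn u x → Conn u y → θ x ≡ θ y → x ≡ y
    injective x y u~x u~y θx≡θy =
      QR-injective-on-component u x y u~x u~y (trans (sym (same-QR x u~x)) (trans (cong QR θx≡θy) (same-QR y u~y)))
    surjective : ∀ y → Conn v y → ∃[ x ] (Conn u x × θ x ≡ y)
    surjective y v~y with QR-transport v y u (sym QRu≡QRv) v~y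
    ... | x , u~x , same = x , u~x , QR-injective-on-component v (θ x) y (into x u~x) v~y (trans (same-QR x u~x) same)
    weight : ∀ x → Conn u x → wt (θ x) ≡ wt x
    weight x u~x = count≡⇒wt≡ (θ x) x (QR≡⇒count≡ (θ x) x (same-QR x u~x))
    edges : ∀ k x y → Conn u x → Conn u y → Edge k x y ⇔ Edge k (θ x) (θ y)
    edges k x y u~x u~y = mk⇔ to from
      where
      to : Edge k x y → Edge k (θ x) (θ y)
      to (h , x↦y) with map≡just⁻ QR (fOp k h (θ x))
        (trans (QR-fOp k h (θ x)) (trans (cong (fᵀ k h) (same-QR x u~x)) (trans (sym (QR-fOp k h x)) (cong (Maybe.map QR) x↦y))))
      ... | z , θx↦z , QRz≡QRy = h , trans θx↦z (cong just (QR-injective-on-component v z (θ y)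
                                     (into x u~x ◅◅ (fwd (k , h , θx↦z) ◅ ε)) (into y u~y) (trans QRz≡QRy (sym (same-QR y u~y)))))
      from : Edge k (θ x) (θ y) → Edge k x y
      from (h , θx↦θy) with map≡just⁻ QR (fOp k h x)
        (trans (QR-fOp k h x) (trans (cong (fᵀ k h) (sym (same-QR x u~x))) (trans (sym (QR-fOp k h (θ x)))
          (trans (cong (Maybe.map QR) θx↦θy) (cong just (same-QR y u~y))))))
      ... | z , x↦z , QRz≡QRy = h , trans x↦z (cong just (QR-injective-on-component u z y (u~x ◅◅ (fwd (k , h , x↦z) ◅ ε)) u~y QRz≡QRy))

  ∼⇒hypo : (u v : Word n) → u ∼ v → u ≡hypo v
  ∼⇒hypo u v (θ , (into , _ , surjective , weight , edges) , θu≡v) =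
    Rigidity.related⇒≡ Related forth back tableaux (u , ε , refl , cong QR θu≡v)
    where
    Related : QRTab n → QRTab n → Set
    Related T T' = ∃[ x ] (Conn u x × QR x ≡ T × QR (θ x) ≡ T')
    forth : ∀ {T T'} k (h : suc k < n) T₁ → Related T T' → fᵀ k h T ≡ just T₁ → ∃[ T₁' ] (fᵀ k h T' ≡ just T₁' × Related T₁ T₁')
    forth k h T₁ (x , u~x , refl , refl) moved with map≡just⁻ QR (fOp k h x) (trans (QR-fOp k h x) moved)
    ... | x₁ , x↦x₁ , refl with Equivalence.to (edges k x x₁ u~x (u~x ◅◅ (fwd (k , h , x↦x₁) ◅ ε))) (h , x↦x₁)
    ...   | _ , θx↦θx₁ = QR (θ x₁) , trans (sym (QR-fOp k h (θ x))) (cong (Maybe.map QR) θx↦θx₁) ,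
                         (x₁ , u~x ◅◅ (fwd (k , h , x↦x₁) ◅ ε) , refl , refl)
    back : ∀ {T T'} k (h : suc k < n) T₁' → Related T T' → fᵀ k h T' ≡ just T₁' → ∃[ T₁ ] (fᵀ k h T ≡ just T₁)
    back k h T₁' (x , u~x , refl , refl) moved with map≡just⁻ QR (fOp k h (θ x)) (trans (QR-fOp k h (θ x)) moved)
    ... | y₁ , θx↦y₁ , _ with surjective y₁ (into x u~x ◅◅ (fwd (k , h , θx↦y₁) ◅ ε))
    ...   | x₁ , u~x₁ , refl with Equivalence.from (edges k x x₁ u~x u~x₁) (h , θx↦y₁)
    ...     | _ , x↦x₁ = QR x₁ , trans (sym (QR-fOp k h x)) (cong (Maybe.map QR) x↦x₁)
    tableaux : ∀ {T T'} → Related T T' → IsQRTableau T × IsQRTableau T' × content T ≡ content T'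
    tableaux (x , u~x , refl , refl) = QR-IsQRTableau x , QR-IsQRTableau (θ x) ,
      Sorted-content-≡ (QR x) (QR (θ x)) (QR-sorted x) (QR-sorted (θ x))
        (count≡⇒countℕ≡ (content (QR x)) (content (QR (θ x)))
          (λ c → trans (count-QR c x) (trans (sym (wt≡⇒count≡ (θ x) x (weight x u~x) c)) (sym (count-QR c (θ x))))))

theorem6p11 : (n : ℕ) (u v : Word n) → (u ≡hypo v) ⇔ (u ∼ v)
theorem6p11 n u v = mk⇔ (hypo⇒∼ u v) (∼⇒hypo u v)
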